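{- Let $M=(E,\rho)$ be a matroid of rank $d\ge1$ with $\#E=m$ and with $\ell$ loops. For all $0\le i\le d$ and $0\le k\le m-\ell$, $$[p^kt^i]\,Y_M(1-p,t)=\delta_{k0}\delta_{id}+(-1)^{k+i-d}\left(\omega_{k+i-d+1}^{i,M}+\omega_{k+i-d}^{i-1,M}\right),$$ where $\delta$ is the Kronecker delta, and $[p^kt^i]\,Y_M(1-p,t)=0$ for all other values of $k$ and $i$.
   Context: A matroid $M=(E,\rho)$ has rank $d=\rho(E)$ and corank function $\sigma(S)=\#S-\rho(S)$. The Tutte polynomial is $T_M(x,y)=\sum_{S\subseteq E}(x-1)^{\rho(E)-\rho(S)}(y-1)^{\sigma(S)}$, and $Y_M(q,t):=(1-q)^{\rho(E)}q^{\sigma(E)}T_M\!\left(\frac{qt+1-q}{1-q},\frac1q\right)$ (a polynomial). For $0\le i\le d-1$, let $\mathcal{S}_i^M=\{S\subseteq E:\rho(S)\ge d-i\}$ ordered by inclusion, $\mathcal{L}_i^M=\{\hat0\}\oplus\mathcal{S}_i^M$ (new minimum adjoined), $\mu_i^M(S)$ the Möbius function $\mu(\hat0,S)$ of $\mathcal{L}_i^M$. For $0\le i\le d-1$ and $1\le j\le m-d+1+i$ put $\omega_j^{i,M}:=(-1)^j\sum_{S\in\mathcal{S}_i^M:\ \#S-d+1+i=j}\mu_i^M(S)$, and $\omega_j^{i,M}:=0$ for all other pairs $(i,j)$. -}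

module Defs where

open import Data.Bool using (Bool; true; false; _∧_; if_then_else_)
open import Data.Nat as ℕ using (ℕ; zero; suc; _∸_; _≡ᵇ_)
open import Data.Integer as ℤ using (ℤ; +_; -_; _+_; _*_; _-_; _≤?_; ∣_∣)
open import Data.Integer.Base using (1ℤ; 0ℤ)
open import Data.Product using (_×_; _,_)
open import Data.List using (List; []; _∷_; _++_; map; concatMap; filterᵇ; length; foldr)
open import Data.Fin using (Fin)
open import Data.Fin.Subset using (Subset; inside; outside; _⊆_; _∪_; _∩_; ⊤; ⁅_⁆) renaming (∣_∣ to card)
open import Data.Fin.Subset.Properties using (_⊂?_)
open import Data.Vec using (_∷_; [])
open import Data.List using (allFin) renaming (length to len)
open import Relation.Nullary.Decidable using (does)
open import Relation.Binary.PropositionalEquality using (_≡_)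

record Matroid (m : ℕ) : Set where
  field
    ρ          : Subset m → ℕ
    ρ-bounded  : ∀ S → ρ S ℕ.≤ card S
    ρ-monotone : ∀ {S T} → S ⊆ T → ρ S ℕ.≤ ρ T
    ρ-submod   : ∀ S T → ρ (S ∪ T) ℕ.+ ρ (S ∩ T) ℕ.≤ ρ S ℕ.+ ρ T

module _ {m : ℕ} (M : Matroid m) where
  open Matroid M

  rank : ℕ
  rank = ρ ⊤

  σ : Subset m → ℕ
  σ S = card S ∸ ρ S

  loops : ℕ
  loops = len (filterᵇ (λ e → does (ρ ⁅ e ⁆ ℕ.≟ 0)) (allFin m))

allSubsets : (n : ℕ) → List (Subset n)
allSubsets zero    = [] ∷ []
allSubsets (suc n) = map (outside ∷_) (allSubsets n) ++ map (inside ∷_) (allSubsets n)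

sumℤ : List ℤ → ℤ
sumℤ = foldr _+_ 0ℤ

-- Bivariate polynomials with integer coefficients in two variables
-- (called X and Y below), represented as formal sums of monomials
-- c · X^a · Y^b.  Only the coefficient extraction `coeff` is meaningful.

Poly : Set
Poly = List (ℤ × ℕ × ℕ)

constP : ℤ → Poly
constP c = (c , 0 , 0) ∷ []

varX varY : Poly
varX = (1ℤ , 1 , 0) ∷ []
varY = (1ℤ , 0 , 1) ∷ []

infixl 6 _+P_ _-P_
infixl 7 _*P_
infixr 8 _^P_

_+P_ : Poly → Poly → Poly
P +P Q = P ++ Q

negP : Poly → Poly
negP = map (λ { (c , a , b) → (- c , a , b) })

_-P_ : Poly → Poly → Poly
P -P Q = P +P negP Q

_*P_ : Poly → Poly → Poly
P *P Q = concatMap (λ { (c , a , b) → map (λ { (c' , a' , b') → (c * c' , a ℕ.+ a' , b ℕ.+ b') }) Q }) P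

_^P_ : Poly → ℕ → Poly
P ^P zero  = constP 1ℤ
P ^P suc n = P *P (P ^P n)

sumP : List Poly → Poly
sumP = foldr _+P_ []

coeff : ℕ → ℕ → Poly → ℤ
coeff a b P = sumℤ (map (λ { (c , a' , b') → if (a ≡ᵇ a') ∧ (b ≡ᵇ b') then c else 0ℤ }) P)

upto : ℕ → List ℕ
upto zero    = zero ∷ []
upto (suc n) = upto n ++ (suc n ∷ [])

module _ {m : ℕ} (M : Matroid m) where
  open Matroid M

  tutte : Poly
  tutte = sumP (map (λ S → ((varX -P constP 1ℤ) ^P (rank M ∸ ρ S))
                          *P ((varY -P constP 1ℤ) ^P σ M S))
                    (allSubsets m))

  -- Y_M(q,t) (q = X, t = Y):
  --   (1-q)^d q^{σ(E)} T_M((qt+1-q)/(1-q), 1/q)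
  -- with the denominators cleared monomial-by-monomial: since T_M has
  -- x-degree ≤ d and y-degree ≤ σ(E), a monomial c x^a y^b of T_M contributes
  --   c (qt+1-q)^a (1-q)^(d-a) q^(σ(E)-b).
  Ypoly : Poly
  Ypoly = sumP (concatMap (λ a → map (λ b →
              constP (coeff a b tutte)
                *P (((varX *P varY) +P (constP 1ℤ -P varX)) ^P a)
                *P ((constP 1ℤ -P varX) ^P (rank M ∸ a))
                *P (varX ^P (σ M ⊤ ∸ b)))
            (upto (σ M ⊤))) (upto (rank M)))

subst1m : Poly → Poly
subst1m P = sumP (map (λ { (c , a , b) → constP c *P ((constP 1ℤ -P varX) ^P a) *P (varY ^P b) }) P)

-- Y_M(1-p,t) (p = X, t = Y)
Y1m : ∀ {m} → Matroid m → Poly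
Y1m M = subst1m (Ypoly M)

-- Möbius functions μ_i^M(Ŝ0,S) in L_i^M = {0̂} ⊕ S_i^M, S_i^M = {S : ρ(S) ≥ d - i}

module _ {m : ℕ} (M : Matroid m) (i : ℕ) where
  open Matroid M

  inSi : Subset m → Bool
  inSi S = does ((rank M ∸ i) ℕ.≤? ρ S)

  -- μ(0̂,S) via the defining recursion μ(0̂,0̂)=1,
  -- μ(0̂,S) = - Σ_{0̂ ≤ T < S} μ(0̂,T) = -(1 + Σ_{T ∈ S_i, T ⊊ S} μ(0̂,T)),
  -- with a fuel argument (fuel ≥ #S suffices, as T ⊊ S has #T < #S).
  μfuel : ℕ → Subset m → ℤ
  μfuel zero    S = - 1ℤ
  μfuel (suc n) S = - (1ℤ + sumℤ (map (μfuel n)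
                        (filterᵇ (λ T → inSi T ∧ does (T ⊂? S)) (allSubsets m))))

  μ : Subset m → ℤ
  μ S = μfuel (card S) S

-- (-1)^n for an integer n (note (-1)^(-n) = (-1)^n)
parity : ℕ → ℤ
parity zero          = 1ℤ
parity (suc zero)    = - 1ℤ
parity (suc (suc n)) = parity n

signℤ : ℤ → ℤ
signℤ n = parity ∣ n ∣

_≤ᵇℤ_ : ℤ → ℤ → Bool
a ≤ᵇℤ b = does (a ≤? b)

ω : ∀ {m} → Matroid m → ℤ → ℤ → ℤ
ω {m} M i j =
  if (0ℤ ≤ᵇℤ i) ∧ (i ≤ᵇℤ (+ d - 1ℤ)) ∧ (1ℤ ≤ᵇℤ j) ∧ (j ≤ᵇℤ (+ m - + d + 1ℤ + i))
  then signℤ j * sumℤ (map (μ M ∣ i ∣)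
         (filterᵇ (λ S → inSi M ∣ i ∣ S ∧ does ((+ card S - + d + 1ℤ + i) ℤ.≟ j))
                 (allSubsets m)))
  else 0ℤ
  where d = rank M

δ : ℕ → ℕ → ℤ
δ a b = if a ≡ᵇ b then 1ℤ else 0ℤ

{-# OPTIONS --safe #-}
module Submission where

-- Expanding T_M over subsets, Y_M(q, t) = Σ_S t^(d - ρ S) q^(m - #S) (1 - q)^#S: the monomials
-- of T_M lie in the box x-degree ≤ d, y-degree ≤ σ(E), so clearing the denominators of Y_M
-- monomial by monomial homogenises each factor (x - 1)^(d - ρ S) (y - 1)^σ(S), with x - 1 ↦ q t
-- and y - 1 ↦ 1 - q. Substituting q = 1 - p and expanding (1 - p)^(m - #S) over the supersets
-- of S gives
--   [p^k t^i] Y_M(1 - p, t) = Σ_{#V = k} Σ_{T ⊆ V} (-1)^#(V ∖ T) [ρ T = d - i].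
-- Writing [ρ T = d - i] = [ρ T ≥ d - i] - [ρ T ≥ d - i + 1] leaves two sums over the up-sets
-- S_i^M and S_{i-1}^M, and for an up-set F the inner sum Σ_{T ⊆ V, T ∈ F} (-1)^#(V ∖ T) is
-- -μ(0̂, V) in {0̂} ⊕ F. This gives the two ω terms; at i = d the first sum is [k = 0], and at
-- i = 0 the second vanishes. Outside the stated range the coefficient vanishes: either
-- i > d ≥ d - ρ T, or k > m - ℓ forces every V with #V = k to contain a loop e, and toggling e
-- pairs off the terms of the alternating sum.

open import Defs
open import Algebra.Bundles using (CommutativeRing)
import Algebra.Properties.CommutativeSemigroup as CommutativeSemigroupProperties
open import Data.Bool using (Bool; true; false; T; _∧_; if_then_else_)
import Data.Bool.Properties as Boolₚ
open import Data.Empty using (⊥-elim)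
open import Data.Fin using (Fin; zero; suc)
open import Data.Fin.Subset using (Subset; inside; outside; _⊆_; ⊤; ∁; ⁅_⁆; _∪_; _∩_)
  renaming (∣_∣ to card; ⊥ to ∅)
open import Data.Fin.Subset.Properties using (_⊆?_; _⊂?_)
import Data.Fin.Subset.Properties as Subsetₚ
open import Data.Integer as ℤ using (ℤ; +_; -[1+_]; -_; _+_; _*_; _-_; _⊖_; 0ℤ; 1ℤ)
import Data.Integer.Properties as ℤₚ
open import Data.Integer.Tactic.RingSolver using (solve-∀)
open import Data.List using (List; []; _∷_; _++_; map; concatMap; filterᵇ; tabulate; allFin)
  renaming (length to len)
import Data.List.Properties as Listₚ
open import Data.List.Relation.Unary.All as All using (All; []; _∷_)
import Data.List.Relation.Unary.All.Properties as Allₚ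
open import Data.Maybe using (nothing)
open import Data.Nat as ℕ using (ℕ; zero; suc; _∸_; _≡ᵇ_; _≤ᵇ_; _≤_; _<_; z≤n; s≤s)
import Data.Nat.Properties as ℕₚ
open import Data.Product using (_×_; _,_; proj₁; proj₂; ∃)
open import Data.Sum as Sum using (_⊎_; inj₁; inj₂)
open import Data.Vec using ([]; _∷_; lookup; _[_]≔_)
open import Function using (_∘_)
open import Function.Bundles using (mk⇔)
open import Level using (0ℓ)
open import Relation.Binary.PropositionalEquality
  using (_≡_; _≢_; refl; sym; trans; cong; cong₂; subst; subst₂; module ≡-Reasoning)
import Relation.Binary.Reasoning.Setoid as SetoidReasoning
open import Relation.Nullary using (¬_; Dec; yes; no)
open import Relation.Nullary.Decidable using (does; dec-true; dec-false; does-⇔)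
open import Tactic.RingSolver.Core.AlmostCommutativeRing using (fromCommutativeRing)
import Tactic.RingSolver.NonReflective as NonReflectiveRingSolver

∑ : {A : Set} → List A → (A → ℤ) → ℤ
∑ xs f = sumℤ (map f xs)

module _ {A : Set} where

  ∑-++ : (xs ys : List A) (f : A → ℤ) → ∑ (xs ++ ys) f ≡ ∑ xs f + ∑ ys f
  ∑-++ []       ys f = sym (ℤₚ.+-identityˡ _)
  ∑-++ (x ∷ xs) ys f = trans (cong (_+_ (f x)) (∑-++ xs ys f)) (sym (ℤₚ.+-assoc (f x) _ _))

  ∑-cong : (xs : List A) {f g : A → ℤ} → (∀ x → f x ≡ g x) → ∑ xs f ≡ ∑ xs g
  ∑-cong []       f≡g = refl
  ∑-cong (x ∷ xs) f≡g = cong₂ _+_ (f≡g x) (∑-cong xs f≡g)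

  ∑-zero : (xs : List A) {f : A → ℤ} → (∀ x → f x ≡ 0ℤ) → ∑ xs f ≡ 0ℤ
  ∑-zero []       f≡0 = refl
  ∑-zero (x ∷ xs) f≡0 = cong₂ _+_ (f≡0 x) (∑-zero xs f≡0)

  ∑-+ : (xs : List A) (f g : A → ℤ) → ∑ xs (λ x → f x + g x) ≡ ∑ xs f + ∑ xs g
  ∑-+ []       f g = refl
  ∑-+ (x ∷ xs) f g =
    trans (cong (_+_ (f x + g x)) (∑-+ xs f g)) (+-interchange (f x) (g x) (∑ xs f) (∑ xs g))
    where open CommutativeSemigroupProperties ℤₚ.+-commutativeSemigroup
            renaming (interchange to +-interchange)

  ∑-*ˡ : (xs : List A) (c : ℤ) (f : A → ℤ) → ∑ xs (λ x → c * f x) ≡ c * ∑ xs f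
  ∑-*ˡ []       c f = sym (ℤₚ.*-zeroʳ c)
  ∑-*ˡ (x ∷ xs) c f = trans (cong (_+_ (c * f x)) (∑-*ˡ xs c f)) (sym (ℤₚ.*-distribˡ-+ c (f x) _))

  ∑-neg : (xs : List A) (f : A → ℤ) → ∑ xs (λ x → - f x) ≡ - ∑ xs f
  ∑-neg []       f = refl
  ∑-neg (x ∷ xs) f = trans (cong (_+_ (- f x)) (∑-neg xs f)) (sym (ℤₚ.neg-distrib-+ (f x) _))

  ∑-sub : (xs : List A) (f g : A → ℤ) → ∑ xs (λ x → f x - g x) ≡ ∑ xs f - ∑ xs g
  ∑-sub xs f g = trans (∑-+ xs f (λ x → - g x)) (cong (_+_ (∑ xs f)) (∑-neg xs g))

  ∑-if : (xs : List A) (b : Bool) (f : A → ℤ) →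
         ∑ xs (λ x → if b then f x else 0ℤ) ≡ (if b then ∑ xs f else 0ℤ)
  ∑-if xs true  f = refl
  ∑-if xs false f = ∑-zero xs (λ _ → refl)

  ∑-filterᵇ : (p : A → Bool) (f : A → ℤ) (xs : List A) →
              ∑ (filterᵇ p xs) f ≡ ∑ xs (λ x → if p x then f x else 0ℤ)
  ∑-filterᵇ p f [] = refl
  ∑-filterᵇ p f (x ∷ xs) with p x
  ... | true  = cong (_+_ (f x)) (∑-filterᵇ p f xs)
  ... | false = trans (∑-filterᵇ p f xs) (sym (ℤₚ.+-identityˡ _))

module _ {A B : Set} where

  ∑-map : (xs : List A) (g : A → B) (f : B → ℤ) → ∑ (map g xs) f ≡ ∑ xs (f ∘ g)
  ∑-map []       g f = refl
  ∑-map (x ∷ xs) g f = cong (_+_ (f (g x))) (∑-map xs g f)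

  ∑-concatMap : (xs : List A) (g : A → List B) (f : B → ℤ) →
                ∑ (concatMap g xs) f ≡ ∑ xs (λ x → ∑ (g x) f)
  ∑-concatMap []       g f = refl
  ∑-concatMap (x ∷ xs) g f =
    trans (∑-++ (g x) (concatMap g xs) f) (cong (_+_ (∑ (g x) f)) (∑-concatMap xs g f))

  ∑-swap : (xs : List A) (ys : List B) (f : A → B → ℤ) →
           ∑ xs (λ x → ∑ ys (f x)) ≡ ∑ ys (λ y → ∑ xs (λ x → f x y))
  ∑-swap []       ys f = sym (∑-zero ys (λ _ → refl))
  ∑-swap (x ∷ xs) ys f = trans (cong (_+_ (∑ ys (f x))) (∑-swap xs ys f)) (sym (∑-+ ys (f x) _))

-- Polynomials up to equality of all coefficients

Mono : Set
Mono = ℤ × ℕ × ℕ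

cf : Mono → ℤ
cf = proj₁

degX degY : Mono → ℕ
degX = proj₁ ∘ proj₂
degY = proj₂ ∘ proj₂

coeffₘ : ℕ → ℕ → Mono → ℤ
coeffₘ a b (c , a′ , b′) = if (a ≡ᵇ a′) ∧ (b ≡ᵇ b′) then c else 0ℤ

infixl 7 _·ₘ_
_·ₘ_ : Mono → Mono → Mono
(c , a , b) ·ₘ (c′ , a′ , b′) = c * c′ , a ℕ.+ a′ , b ℕ.+ b′

coeff-++ : ∀ a b P Q → coeff a b (P ++ Q) ≡ coeff a b P + coeff a b Q
coeff-++ a b P Q = ∑-++ P Q (coeffₘ a b)

coeff-negP : ∀ a b P → coeff a b (negP P) ≡ - coeff a b P
coeff-negP a b P = trans (∑-map P _ (coeffₘ a b)) (trans (∑-cong P coeffₘ-neg) (∑-neg P (coeffₘ a b)))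
  where
  coeffₘ-neg : ∀ p → coeffₘ a b (- cf p , proj₂ p) ≡ - coeffₘ a b p
  coeffₘ-neg (c , a′ , b′) with (a ≡ᵇ a′) ∧ (b ≡ᵇ b′)
  ... | true  = refl
  ... | false = refl

coeff-*P : ∀ a b P Q → coeff a b (P *P Q) ≡ ∑ P (λ p → ∑ Q (λ q → coeffₘ a b (p ·ₘ q)))
coeff-*P a b P Q = trans (∑-concatMap P _ (coeffₘ a b)) (∑-cong P (λ p → ∑-map Q _ (coeffₘ a b)))

≤ᵇ-suc : ∀ a b → (suc a ≤ᵇ suc b) ≡ (a ≤ᵇ b)
≤ᵇ-suc zero    b = refl
≤ᵇ-suc (suc a) b = refl

≡ᵇ-+ : ∀ a a₁ a₂ → (a ≡ᵇ a₁ ℕ.+ a₂) ≡ ((a₁ ≤ᵇ a) ∧ (a ∸ a₁ ≡ᵇ a₂))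
≡ᵇ-+ a       zero     a₂ = refl
≡ᵇ-+ zero    (suc a₁) a₂ = refl
≡ᵇ-+ (suc a) (suc a₁) a₂ = trans (≡ᵇ-+ a a₁ a₂) (cong (_∧ (a ∸ a₁ ≡ᵇ a₂)) (sym (≤ᵇ-suc a₁ a)))

if-*ʳ : ∀ B c c′ → (if B then c * c′ else 0ℤ) ≡ c * (if B then c′ else 0ℤ)
if-*ʳ true  c c′ = refl
if-*ʳ false c c′ = sym (ℤₚ.*-zeroʳ c)

divides : Mono → ℕ → ℕ → Bool
divides p a b = (degX p ≤ᵇ a) ∧ (degY p ≤ᵇ b)

quotCoeff : ℕ → ℕ → Mono → Poly → ℤ
quotCoeff a b p Q = if divides p a b then coeff (a ∸ degX p) (b ∸ degY p) Q else 0ℤ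

coeffₘ-·ₘ : ∀ a b p q →
  coeffₘ a b (p ·ₘ q) ≡ cf p * (if divides p a b then coeffₘ (a ∸ degX p) (b ∸ degY p) q else 0ℤ)
coeffₘ-·ₘ a b (c , a₁ , b₁) (c′ , a₂ , b₂)
  rewrite ≡ᵇ-+ a a₁ a₂ | ≡ᵇ-+ b b₁ b₂ with a₁ ≤ᵇ a | b₁ ≤ᵇ b
... | true  | true  = if-*ʳ ((a ∸ a₁ ≡ᵇ a₂) ∧ (b ∸ b₁ ≡ᵇ b₂)) c c′
... | true  | false = trans (if-*ʳ ((a ∸ a₁ ≡ᵇ a₂) ∧ false) c c′)
                            (cong (λ B → c * (if B then c′ else 0ℤ)) (Boolₚ.∧-zeroʳ (a ∸ a₁ ≡ᵇ a₂)))
... | false | _     = sym (ℤₚ.*-zeroʳ c)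

∑-coeffₘ-·ₘ : ∀ a b p Q → ∑ Q (λ q → coeffₘ a b (p ·ₘ q)) ≡ cf p * quotCoeff a b p Q
∑-coeffₘ-·ₘ a b p Q = begin
  ∑ Q (λ q → coeffₘ a b (p ·ₘ q))
    ≡⟨ ∑-cong Q (coeffₘ-·ₘ a b p) ⟩
  ∑ Q (λ q → cf p * (if divides p a b then coeffₘ (a ∸ degX p) (b ∸ degY p) q else 0ℤ))
    ≡⟨ ∑-*ˡ Q (cf p) _ ⟩
  cf p * ∑ Q (λ q → if divides p a b then coeffₘ (a ∸ degX p) (b ∸ degY p) q else 0ℤ)
    ≡⟨ cong (cf p *_) (∑-if Q (divides p a b) _) ⟩
  cf p * quotCoeff a b p Q ∎
  where open ≡-Reasoning

infix 4 _≈_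
record _≈_ (P Q : Poly) : Set where
  constructor mk≈
  field coeff-≈ : ∀ a b → coeff a b P ≡ coeff a b Q
open _≈_

≈-refl : ∀ {P} → P ≈ P
≈-refl = mk≈ λ _ _ → refl

≈-sym : ∀ {P Q} → P ≈ Q → Q ≈ P
≈-sym (mk≈ e) = mk≈ λ a b → sym (e a b)

≈-trans : ∀ {P Q R} → P ≈ Q → Q ≈ R → P ≈ R
≈-trans (mk≈ e) (mk≈ f) = mk≈ λ a b → trans (e a b) (f a b)

≡⇒≈ : ∀ {P Q} → P ≡ Q → P ≈ Q
≡⇒≈ refl = ≈-refl

+P-cong : ∀ {P P′ Q Q′} → P ≈ P′ → Q ≈ Q′ → P +P Q ≈ P′ +P Q′
+P-cong {P} {P′} {Q} {Q′} (mk≈ e) (mk≈ f) = mk≈ λ a b →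
  trans (coeff-++ a b P Q) (trans (cong₂ _+_ (e a b) (f a b)) (sym (coeff-++ a b P′ Q′)))

negP-cong : ∀ {P P′} → P ≈ P′ → negP P ≈ negP P′
negP-cong {P} {P′} (mk≈ e) = mk≈ λ a b →
  trans (coeff-negP a b P) (trans (cong -_ (e a b)) (sym (coeff-negP a b P′)))

+P-assoc : ∀ P Q R → (P +P Q) +P R ≈ P +P (Q +P R)
+P-assoc P Q R = ≡⇒≈ (Listₚ.++-assoc P Q R)

+P-identityʳ : ∀ P → P +P [] ≈ P
+P-identityʳ P = ≡⇒≈ (Listₚ.++-identityʳ P)

+P-comm : ∀ P Q → P +P Q ≈ Q +P P
+P-comm P Q = mk≈ λ a b →
  trans (coeff-++ a b P Q) (trans (ℤₚ.+-comm (coeff a b P) _) (sym (coeff-++ a b Q P)))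

+P-inverseʳ : ∀ P → P -P P ≈ []
+P-inverseʳ P = mk≈ λ a b →
  trans (coeff-++ a b P (negP P)) (trans (cong (_+_ (coeff a b P)) (coeff-negP a b P)) (ℤₚ.+-inverseʳ (coeff a b P)))

*P-congˡ : ∀ P {Q Q′} → Q ≈ Q′ → P *P Q ≈ P *P Q′
*P-congˡ P {Q} {Q′} (mk≈ e) = mk≈ λ a b → begin
  coeff a b (P *P Q)                 ≡⟨ coeff-*P a b P Q ⟩
  ∑ P (λ p → ∑ Q (λ q → coeffₘ a b (p ·ₘ q)))  ≡⟨ ∑-cong P (λ p → ∑-coeffₘ-·ₘ a b p Q) ⟩
  ∑ P (λ p → cf p * quotCoeff a b p Q)          ≡⟨ ∑-cong P (λ p → cong (cf p *_) (quotCoeff-cong a b p)) ⟩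
  ∑ P (λ p → cf p * quotCoeff a b p Q′)         ≡⟨ ∑-cong P (λ p → ∑-coeffₘ-·ₘ a b p Q′) ⟨
  ∑ P (λ p → ∑ Q′ (λ q → coeffₘ a b (p ·ₘ q))) ≡⟨ coeff-*P a b P Q′ ⟨
  coeff a b (P *P Q′)                ∎
  where
  open ≡-Reasoning
  quotCoeff-cong : ∀ a b p → quotCoeff a b p Q ≡ quotCoeff a b p Q′
  quotCoeff-cong a b p with divides p a b
  ... | true  = e (a ∸ degX p) (b ∸ degY p)
  ... | false = refl

·ₘ-comm : ∀ p q → p ·ₘ q ≡ q ·ₘ p
·ₘ-comm (c , a , b) (c′ , a′ , b′) =
  cong₂ _,_ (ℤₚ.*-comm c c′) (cong₂ _,_ (ℕₚ.+-comm a a′) (ℕₚ.+-comm b b′))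

·ₘ-assoc : ∀ p q r → (p ·ₘ q) ·ₘ r ≡ p ·ₘ (q ·ₘ r)
·ₘ-assoc (c , a , b) (c′ , a′ , b′) (c″ , a″ , b″) =
  cong₂ _,_ (ℤₚ.*-assoc c c′ c″) (cong₂ _,_ (ℕₚ.+-assoc a a′ a″) (ℕₚ.+-assoc b b′ b″))

*P-comm : ∀ P Q → P *P Q ≈ Q *P P
*P-comm P Q = mk≈ λ a b → begin
  coeff a b (P *P Q)                           ≡⟨ coeff-*P a b P Q ⟩
  ∑ P (λ p → ∑ Q (λ q → coeffₘ a b (p ·ₘ q)))  ≡⟨ ∑-swap P Q _ ⟩
  ∑ Q (λ q → ∑ P (λ p → coeffₘ a b (p ·ₘ q)))  ≡⟨ ∑-cong Q (λ q → ∑-cong P (λ p → cong (coeffₘ a b) (·ₘ-comm p q))) ⟩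
  ∑ Q (λ q → ∑ P (λ p → coeffₘ a b (q ·ₘ p)))  ≡⟨ coeff-*P a b Q P ⟨
  coeff a b (Q *P P)                           ∎
  where open ≡-Reasoning

*P-cong : ∀ {P P′ Q Q′} → P ≈ P′ → Q ≈ Q′ → P *P Q ≈ P′ *P Q′
*P-cong {P} {P′} {Q} {Q′} e f =
  ≈-trans (*P-congˡ P f) (≈-trans (*P-comm P Q′) (≈-trans (*P-congˡ Q′ e) (*P-comm Q′ P′)))

*P-congʳ : ∀ {P P′} Q → P ≈ P′ → P *P Q ≈ P′ *P Q
*P-congʳ Q P≈P′ = *P-cong P≈P′ ≈-refl

*P-assoc : ∀ P Q R → (P *P Q) *P R ≈ P *P (Q *P R)
*P-assoc P Q R = mk≈ λ a b → begin
  coeff a b ((P *P Q) *P R)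
    ≡⟨ coeff-*P a b (P *P Q) R ⟩
  ∑ (P *P Q) (λ x → ∑ R (λ r → coeffₘ a b (x ·ₘ r)))
    ≡⟨ ∑-concatMap P _ _ ⟩
  ∑ P (λ p → ∑ (map (p ·ₘ_) Q) (λ x → ∑ R (λ r → coeffₘ a b (x ·ₘ r))))
    ≡⟨ ∑-cong P (λ p → ∑-map Q (p ·ₘ_) _) ⟩
  ∑ P (λ p → ∑ Q (λ q → ∑ R (λ r → coeffₘ a b ((p ·ₘ q) ·ₘ r))))
    ≡⟨ ∑-cong P (λ p → ∑-cong Q (λ q → ∑-cong R (λ r → cong (coeffₘ a b) (·ₘ-assoc p q r)))) ⟩
  ∑ P (λ p → ∑ Q (λ q → ∑ R (λ r → coeffₘ a b (p ·ₘ (q ·ₘ r)))))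
    ≡⟨ ∑-cong P (λ p → trans (∑-concatMap Q _ _) (∑-cong Q (λ q → ∑-map R (q ·ₘ_) _))) ⟨
  ∑ P (λ p → ∑ (Q *P R) (λ y → coeffₘ a b (p ·ₘ y)))
    ≡⟨ coeff-*P a b P (Q *P R) ⟨
  coeff a b (P *P (Q *P R)) ∎
  where open ≡-Reasoning

*P-identityˡ : ∀ P → constP 1ℤ *P P ≈ P
*P-identityˡ P = mk≈ λ a b → begin
  coeff a b (constP 1ℤ *P P)           ≡⟨ coeff-*P a b (constP 1ℤ) P ⟩
  ∑ P (λ q → coeffₘ a b ((1ℤ , 0 , 0) ·ₘ q)) + 0ℤ ≡⟨ ℤₚ.+-identityʳ _ ⟩
  ∑ P (λ q → coeffₘ a b ((1ℤ , 0 , 0) ·ₘ q))      ≡⟨ ∑-cong P (λ q → cong (coeffₘ a b) (1·ₘ q)) ⟩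
  coeff a b P                          ∎
  where
  open ≡-Reasoning
  1·ₘ : ∀ q → (1ℤ , 0 , 0) ·ₘ q ≡ q
  1·ₘ (c , a , b) = cong (_, a , b) (ℤₚ.*-identityˡ c)

*P-identityʳ : ∀ P → P *P constP 1ℤ ≈ P
*P-identityʳ P = ≈-trans (*P-comm P (constP 1ℤ)) (*P-identityˡ P)

*P-distribˡ : ∀ P Q R → P *P (Q +P R) ≈ (P *P Q) +P (P *P R)
*P-distribˡ P Q R = mk≈ λ a b → begin
  coeff a b (P *P (Q +P R))
    ≡⟨ coeff-*P a b P (Q ++ R) ⟩
  ∑ P (λ p → ∑ (Q ++ R) (λ q → coeffₘ a b (p ·ₘ q)))
    ≡⟨ ∑-cong P (λ p → ∑-++ Q R _) ⟩
  ∑ P (λ p → ∑ Q (λ q → coeffₘ a b (p ·ₘ q)) + ∑ R (λ q → coeffₘ a b (p ·ₘ q)))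
    ≡⟨ ∑-+ P _ _ ⟩
  ∑ P (λ p → ∑ Q (λ q → coeffₘ a b (p ·ₘ q))) + ∑ P (λ p → ∑ R (λ q → coeffₘ a b (p ·ₘ q)))
    ≡⟨ cong₂ _+_ (coeff-*P a b P Q) (coeff-*P a b P R) ⟨
  coeff a b (P *P Q) + coeff a b (P *P R)
    ≡⟨ coeff-++ a b (P *P Q) _ ⟨
  coeff a b ((P *P Q) +P (P *P R)) ∎
  where open ≡-Reasoning

polyRing : CommutativeRing 0ℓ 0ℓ
polyRing = record
  { Carrier = Poly
  ; _≈_ = _≈_
  ; _+_ = _+P_
  ; _*_ = _*P_
  ; -_ = negP
  ; 0# = []
  ; 1# = constP 1ℤ
  ; isCommutativeRing = record
    { isRing = record
      { +-isAbelianGroup = record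
        { isGroup = record
          { isMonoid = record
            { isSemigroup = record
              { isMagma = record
                { isEquivalence = record { refl = ≈-refl ; sym = ≈-sym ; trans = ≈-trans }
                ; ∙-cong = +P-cong }
              ; assoc = +P-assoc }
            ; identity = (λ _ → ≈-refl) , +P-identityʳ }
          ; inverse = (λ P → ≈-trans (+P-comm (negP P) P) (+P-inverseʳ P)) , +P-inverseʳ
          ; ⁻¹-cong = negP-cong }
        ; comm = +P-comm }
      ; *-cong = *P-cong
      ; *-assoc = *P-assoc
      ; *-identity = *P-identityˡ , *P-identityʳ
      ; distrib = *P-distribˡ
                , (λ P Q R → ≈-trans (*P-comm (Q +P R) P)
                               (≈-trans (*P-distribˡ P Q R) (+P-cong (*P-comm P Q) (*P-comm P R)))) }
    ; *-comm = *P-comm } }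

open NonReflectiveRingSolver (fromCommutativeRing polyRing (λ _ → nothing))
  using (solve; _⊜_; _⊕_; _⊗_; ⊝_)
module ≈-Reasoning = SetoidReasoning (CommutativeRing.setoid polyRing)

ΣP : {A : Set} → List A → (A → Poly) → Poly
ΣP xs f = sumP (map f xs)

coeff-ΣP : ∀ {A : Set} a b (xs : List A) f → coeff a b (ΣP xs f) ≡ ∑ xs (λ x → coeff a b (f x))
coeff-ΣP a b []       f = refl
coeff-ΣP a b (x ∷ xs) f = trans (coeff-++ a b (f x) (ΣP xs f)) (cong (_+_ (coeff a b (f x))) (coeff-ΣP a b xs f))

module _ {A : Set} where

  ΣP-cong : (xs : List A) {f g : A → Poly} → (∀ x → f x ≈ g x) → ΣP xs f ≈ ΣP xs g
  ΣP-cong xs {f} {g} f≈g = mk≈ λ a b →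
    trans (coeff-ΣP a b xs f) (trans (∑-cong xs (λ x → coeff-≈ (f≈g x) a b)) (sym (coeff-ΣP a b xs g)))

  ΣP-congᴬ : {xs : List A} {f g : A → Poly} → All (λ x → f x ≈ g x) xs → ΣP xs f ≈ ΣP xs g
  ΣP-congᴬ []         = ≈-refl
  ΣP-congᴬ (e ∷ es) = +P-cong e (ΣP-congᴬ es)

  ΣP-zero : (xs : List A) → ΣP xs (λ _ → []) ≈ []
  ΣP-zero xs = mk≈ λ a b → trans (coeff-ΣP a b xs _) (∑-zero xs (λ _ → refl))

  ΣP-+ : (xs : List A) (f g : A → Poly) → ΣP xs (λ x → f x +P g x) ≈ ΣP xs f +P ΣP xs g
  ΣP-+ xs f g = mk≈ λ a b → begin
    coeff a b (ΣP xs (λ x → f x +P g x))                    ≡⟨ coeff-ΣP a b xs _ ⟩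
    ∑ xs (λ x → coeff a b (f x +P g x))                     ≡⟨ ∑-cong xs (λ x → coeff-++ a b (f x) (g x)) ⟩
    ∑ xs (λ x → coeff a b (f x) + coeff a b (g x))          ≡⟨ ∑-+ xs _ _ ⟩
    ∑ xs (λ x → coeff a b (f x)) + ∑ xs (λ x → coeff a b (g x)) ≡⟨ cong₂ _+_ (coeff-ΣP a b xs f) (coeff-ΣP a b xs g) ⟨
    coeff a b (ΣP xs f) + coeff a b (ΣP xs g)               ≡⟨ coeff-++ a b (ΣP xs f) (ΣP xs g) ⟨
    coeff a b (ΣP xs f +P ΣP xs g)                          ∎
    where open ≡-Reasoning

  ΣP-neg : (xs : List A) (f : A → Poly) → ΣP xs (λ x → negP (f x)) ≈ negP (ΣP xs f)
  ΣP-neg xs f = mk≈ λ a b → begin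
    coeff a b (ΣP xs (λ x → negP (f x))) ≡⟨ coeff-ΣP a b xs _ ⟩
    ∑ xs (λ x → coeff a b (negP (f x)))  ≡⟨ ∑-cong xs (λ x → coeff-negP a b (f x)) ⟩
    ∑ xs (λ x → - coeff a b (f x))       ≡⟨ ∑-neg xs _ ⟩
    - ∑ xs (λ x → coeff a b (f x))       ≡⟨ cong -_ (coeff-ΣP a b xs f) ⟨
    - coeff a b (ΣP xs f)                ≡⟨ coeff-negP a b (ΣP xs f) ⟨
    coeff a b (negP (ΣP xs f))           ∎
    where open ≡-Reasoning

  ΣP-*ˡ : (xs : List A) (Q : Poly) (f : A → Poly) → ΣP xs (λ x → Q *P f x) ≈ Q *P ΣP xs f
  ΣP-*ˡ []       Q f = mk≈ λ a b → sym (trans (coeff-*P a b Q []) (∑-zero Q (λ _ → refl)))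
  ΣP-*ˡ (x ∷ xs) Q f =
    ≈-trans (+P-cong (≈-refl {Q *P f x}) (ΣP-*ˡ xs Q f)) (≈-sym (*P-distribˡ Q (f x) (ΣP xs f)))

  ΣP-++ : (xs ys : List A) (f : A → Poly) → ΣP (xs ++ ys) f ≈ ΣP xs f +P ΣP ys f
  ΣP-++ xs ys f = mk≈ λ a b → begin
    coeff a b (ΣP (xs ++ ys) f)                                 ≡⟨ coeff-ΣP a b (xs ++ ys) f ⟩
    ∑ (xs ++ ys) (λ x → coeff a b (f x))                        ≡⟨ ∑-++ xs ys _ ⟩
    ∑ xs (λ x → coeff a b (f x)) + ∑ ys (λ x → coeff a b (f x)) ≡⟨ cong₂ _+_ (coeff-ΣP a b xs f) (coeff-ΣP a b ys f) ⟨
    coeff a b (ΣP xs f) + coeff a b (ΣP ys f)                   ≡⟨ coeff-++ a b (ΣP xs f) (ΣP ys f) ⟨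
    coeff a b (ΣP xs f +P ΣP ys f)                              ∎
    where open ≡-Reasoning

module _ {A B : Set} where

  ΣP-map : (xs : List A) (g : A → B) (f : B → Poly) → ΣP (map g xs) f ≈ ΣP xs (f ∘ g)
  ΣP-map xs g f = mk≈ λ a b →
    trans (coeff-ΣP a b (map g xs) f) (trans (∑-map xs g _) (sym (coeff-ΣP a b xs _)))

  ΣP-concatMap : (xs : List A) (g : A → List B) (f : B → Poly) →
                 ΣP (concatMap g xs) f ≈ ΣP xs (λ x → ΣP (g x) f)
  ΣP-concatMap xs g f = mk≈ λ a b → begin
    coeff a b (ΣP (concatMap g xs) f)            ≡⟨ coeff-ΣP a b (concatMap g xs) f ⟩
    ∑ (concatMap g xs) (λ y → coeff a b (f y))   ≡⟨ ∑-concatMap xs g _ ⟩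
    ∑ xs (λ x → ∑ (g x) (λ y → coeff a b (f y))) ≡⟨ ∑-cong xs (λ x → coeff-ΣP a b (g x) f) ⟨
    ∑ xs (λ x → coeff a b (ΣP (g x) f))          ≡⟨ coeff-ΣP a b xs _ ⟨
    coeff a b (ΣP xs (λ x → ΣP (g x) f))         ∎
    where open ≡-Reasoning

linExt : (Mono → Poly) → Poly → Poly
linExt h P = ΣP P h

linExt-sumP : ∀ h Ps → linExt h (sumP Ps) ≈ ΣP Ps (linExt h)
linExt-sumP h []       = ≈-refl
linExt-sumP h (P ∷ Ps) = ≈-trans (ΣP-++ P (sumP Ps) h) (+P-cong (≈-refl {linExt h P}) (linExt-sumP h Ps))

linExt-negP : ∀ h → (∀ p → h (- cf p , proj₂ p) ≈ negP (h p)) →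
              ∀ P → linExt h (negP P) ≈ negP (linExt h P)
linExt-negP h h-neg P = ≈-trans (ΣP-map P _ h) (≈-trans (ΣP-cong P h-neg) (ΣP-neg P h))

linExt-*P : ∀ h h₁ h₂ P Q → All (λ p → All (λ q → h (p ·ₘ q) ≈ h₁ p *P h₂ q) Q) P →
            linExt h (P *P Q) ≈ linExt h₁ P *P linExt h₂ Q
linExt-*P h h₁ h₂ P Q h-mult = begin
  ΣP (P *P Q) h                          ≈⟨ ΣP-concatMap P _ h ⟩
  ΣP P (λ p → ΣP (map (p ·ₘ_) Q) h)      ≈⟨ ΣP-cong P (λ p → ΣP-map Q (p ·ₘ_) h) ⟩
  ΣP P (λ p → ΣP Q (λ q → h (p ·ₘ q)))   ≈⟨ ΣP-congᴬ (All.map ΣP-congᴬ h-mult) ⟩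
  ΣP P (λ p → ΣP Q (λ q → h₁ p *P h₂ q)) ≈⟨ ΣP-cong P (λ p → ΣP-*ˡ Q (h₁ p) h₂) ⟩
  ΣP P (λ p → h₁ p *P ΣP Q h₂)           ≈⟨ ΣP-cong P (λ p → *P-comm (h₁ p) (ΣP Q h₂)) ⟩
  ΣP P (λ p → ΣP Q h₂ *P h₁ p)           ≈⟨ ΣP-*ˡ P (ΣP Q h₂) h₁ ⟩
  ΣP Q h₂ *P ΣP P h₁                     ≈⟨ *P-comm (ΣP Q h₂) (ΣP P h₁) ⟩
  ΣP P h₁ *P ΣP Q h₂                     ∎
  where open ≈-Reasoning

All-*P : ∀ {Pp Pq Pr : Mono → Set} P Q → All Pp P → All Pq Q →
         (∀ {p q} → Pp p → Pq q → Pr (p ·ₘ q)) → All Pr (P *P Q)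
All-*P []      Q []         Q-ok close = []
All-*P (p ∷ P) Q (pp ∷ P-ok) Q-ok close =
  Allₚ.++⁺ (Allₚ.map⁺ (All.map (close pp) Q-ok)) (All-*P P Q P-ok Q-ok close)

All-sumP : ∀ {Pr : Mono → Set} Ps → All (All Pr) Ps → All Pr (sumP Ps)
All-sumP []       []           = []
All-sumP (P ∷ Ps) (P-ok ∷ Ps-ok) = Allₚ.++⁺ P-ok (All-sumP Ps Ps-ok)

^P-cong : ∀ {P Q} n → P ≈ Q → P ^P n ≈ Q ^P n
^P-cong zero    P≈Q = ≈-refl
^P-cong (suc n) P≈Q = *P-cong P≈Q (^P-cong n P≈Q)

^P-+ : ∀ P m n → P ^P (m ℕ.+ n) ≈ P ^P m *P P ^P n
^P-+ P zero    n = ≈-sym (*P-identityˡ (P ^P n))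
^P-+ P (suc m) n = ≈-trans (*P-congˡ P (^P-+ P m n)) (≈-sym (*P-assoc P (P ^P m) (P ^P n)))

^P-*P : ∀ P Q n → (P *P Q) ^P n ≈ P ^P n *P Q ^P n
^P-*P P Q zero    = ≈-sym (*P-identityˡ (constP 1ℤ))
^P-*P P Q (suc n) = ≈-trans (*P-congˡ (P *P Q) (^P-*P P Q n))
  (solve 4 (λ p q a b → (p ⊗ q) ⊗ (a ⊗ b) ⊜ (p ⊗ a) ⊗ (q ⊗ b)) ≈-refl P Q (P ^P n) (Q ^P n))

1^P : ∀ n → constP 1ℤ ^P n ≈ constP 1ℤ
1^P zero    = ≈-refl
1^P (suc n) = ≈-trans (*P-identityˡ _) (1^P n)

All-^P : ∀ {Pr : Mono → Set} P n → Pr (1ℤ , 0 , 0) → (∀ {p q} → Pr p → Pr q → Pr (p ·ₘ q)) →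
         All Pr P → All Pr (P ^P n)
All-^P P zero    Pr-1 close P-ok = Pr-1 ∷ []
All-^P P (suc n) Pr-1 close P-ok = All-*P P (P ^P n) P-ok (All-^P P n Pr-1 close P-ok) close

-- Homogenising powers of x - 1

module Homogenisation (deg : Mono → ℕ) (e : ℕ × ℕ)
  (deg-1 : deg (1ℤ , 0 , 0) ≡ 0)
  (deg-x· : ∀ p → deg ((1ℤ , e) ·ₘ p) ≡ suc (deg p))
  (deg-[-1]· : ∀ p → deg ((- 1ℤ , 0 , 0) ·ₘ p) ≡ deg p) where

  x-1 : Poly
  x-1 = (1ℤ , e) ∷ (- 1ℤ , 0 , 0) ∷ []

  homogenise : Poly → Poly → ℕ → Mono → Poly
  homogenise U V D p = constP (cf p) *P (U ^P deg p *P V ^P (D ∸ deg p))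

  deg-x-1^P : ∀ α → All (λ p → deg p ≤ α) (x-1 ^P α)
  deg-x-1^P zero    = ℕₚ.≤-reflexive deg-1 ∷ []
  deg-x-1^P (suc α) =
    Allₚ.++⁺ (Allₚ.map⁺ (All.map (λ {p} p≤α → ℕₚ.≤-trans (ℕₚ.≤-reflexive (deg-x· p)) (s≤s p≤α)) ih))
             (Allₚ.++⁺ (Allₚ.map⁺ (All.map (λ {p} p≤α → ℕₚ.≤-trans (ℕₚ.≤-reflexive (deg-[-1]· p))
                                                                  (ℕₚ.m≤n⇒m≤1+n p≤α)) ih)) [])
    where ih = deg-x-1^P α

  homogenise-x· : ∀ U V D p → homogenise U V (suc D) ((1ℤ , e) ·ₘ p) ≈ U *P homogenise U V D p
  homogenise-x· U V D p = begin
    constP (1ℤ * cf p) *P (U ^P deg ((1ℤ , e) ·ₘ p) *P V ^P (suc D ∸ deg ((1ℤ , e) ·ₘ p)))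
      ≈⟨ ≡⇒≈ (cong₂ (λ c n → constP c *P (U ^P n *P V ^P (suc D ∸ n))) (ℤₚ.*-identityˡ (cf p)) (deg-x· p)) ⟩
    constP (cf p) *P ((U *P U ^P deg p) *P V ^P (D ∸ deg p))
      ≈⟨ solve 4 (λ c u x y → c ⊗ ((u ⊗ x) ⊗ y) ⊜ u ⊗ (c ⊗ (x ⊗ y))) ≈-refl
               (constP (cf p)) U (U ^P deg p) (V ^P (D ∸ deg p)) ⟩
    U *P homogenise U V D p ∎
    where open ≈-Reasoning

  homogenise-[-1]· : ∀ U V D p → deg p ≤ D →
    homogenise U V (suc D) ((- 1ℤ , 0 , 0) ·ₘ p) ≈ negP (V *P homogenise U V D p)
  homogenise-[-1]· U V D p p≤D = begin
    constP (- 1ℤ * cf p) *P (U ^P deg ((- 1ℤ , 0 , 0) ·ₘ p) *P V ^P (suc D ∸ deg ((- 1ℤ , 0 , 0) ·ₘ p)))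
      ≈⟨ ≡⇒≈ (cong₂ (λ c n → constP c *P (U ^P n *P V ^P (suc D ∸ n))) (ℤₚ.-1*i≡-i (cf p)) (deg-[-1]· p)) ⟩
    negP (constP (cf p)) *P (U ^P deg p *P V ^P (suc D ∸ deg p))
      ≈⟨ *P-congˡ (negP (constP (cf p))) (*P-congˡ (U ^P deg p) (≡⇒≈ (cong (V ^P_) (ℕₚ.+-∸-assoc 1 p≤D)))) ⟩
    negP (constP (cf p)) *P (U ^P deg p *P (V *P V ^P (D ∸ deg p)))
      ≈⟨ solve 4 (λ c u v y → (⊝ c) ⊗ (u ⊗ (v ⊗ y)) ⊜ ⊝ (v ⊗ (c ⊗ (u ⊗ y)))) ≈-refl
               (constP (cf p)) (U ^P deg p) V (V ^P (D ∸ deg p)) ⟩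
    negP (V *P homogenise U V D p) ∎
    where open ≈-Reasoning

  homogenise-x-1^P : ∀ U V D α → α ≤ D →
    linExt (homogenise U V D) (x-1 ^P α) ≈ (U -P V) ^P α *P V ^P (D ∸ α)
  homogenise-x-1^P U V D zero _ = begin
    homogenise U V D (1ℤ , 0 , 0) +P []
      ≈⟨ +P-identityʳ _ ⟩
    constP 1ℤ *P (U ^P deg (1ℤ , 0 , 0) *P V ^P (D ∸ deg (1ℤ , 0 , 0)))
      ≈⟨ ≡⇒≈ (cong (λ n → constP 1ℤ *P (U ^P n *P V ^P (D ∸ n))) deg-1) ⟩
    constP 1ℤ *P (constP 1ℤ *P V ^P D)
      ≈⟨ *P-identityˡ _ ⟩
    constP 1ℤ *P V ^P D ∎
    where open ≈-Reasoning
  homogenise-x-1^P U V (suc D) (suc α) (s≤s α≤D) = begin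
    linExt h′ (map ((1ℤ , e) ·ₘ_) P ++ (map ((- 1ℤ , 0 , 0) ·ₘ_) P ++ []))
      ≈⟨ ΣP-++ (map ((1ℤ , e) ·ₘ_) P) _ h′ ⟩
    linExt h′ (map ((1ℤ , e) ·ₘ_) P) +P linExt h′ (map ((- 1ℤ , 0 , 0) ·ₘ_) P ++ [])
      ≈⟨ +P-cong (ΣP-map P _ h′) (≈-trans (ΣP-++ (map _ P) [] h′) (≈-trans (+P-identityʳ _) (ΣP-map P _ h′))) ⟩
    ΣP P (h′ ∘ ((1ℤ , e) ·ₘ_)) +P ΣP P (h′ ∘ ((- 1ℤ , 0 , 0) ·ₘ_))
      ≈⟨ +P-cong (ΣP-cong P (homogenise-x· U V D))
                 (ΣP-congᴬ (All.map (λ {p} → homogenise-[-1]· U V D p ∘ (λ p≤α → ℕₚ.≤-trans p≤α α≤D))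
                                    (deg-x-1^P α))) ⟩
    ΣP P (λ p → U *P h p) +P ΣP P (λ p → negP (V *P h p))
      ≈⟨ +P-cong (ΣP-*ˡ P U h) (≈-trans (ΣP-neg P _) (negP-cong (ΣP-*ˡ P V h))) ⟩
    U *P linExt h P +P negP (V *P linExt h P)
      ≈⟨ +P-cong (*P-congˡ U ih) (negP-cong (*P-congˡ V ih)) ⟩
    U *P (A *P B) +P negP (V *P (A *P B))
      ≈⟨ solve 4 (λ u v a b → u ⊗ (a ⊗ b) ⊕ ⊝ (v ⊗ (a ⊗ b)) ⊜ ((u ⊕ ⊝ v) ⊗ a) ⊗ b) ≈-refl U V A B ⟩
    ((U -P V) *P A) *P B ∎
    where
    open ≈-Reasoning
    P = x-1 ^P α
    h = homogenise U V D
    h′ = homogenise U V (suc D)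
    A = (U -P V) ^P α
    B = V ^P (D ∸ α)
    ih = homogenise-x-1^P U V D α α≤D

module HomogenisationX = Homogenisation degX (1 , 0) refl (λ _ → refl) (λ _ → refl)
module HomogenisationY = Homogenisation degY (0 , 1) refl (λ _ → refl) (λ _ → refl)

degY-x-1^P : ∀ α → All (λ p → degY p ≡ 0) (HomogenisationX.x-1 ^P α)
degY-x-1^P α = All-^P HomogenisationX.x-1 α refl (cong₂ ℕ._+_) (refl ∷ refl ∷ [])

degX-y-1^P : ∀ β → All (λ p → degX p ≡ 0) (HomogenisationY.x-1 ^P β)
degX-y-1^P β = All-^P HomogenisationY.x-1 β refl (cong₂ ℕ._+_) (refl ∷ refl ∷ [])

-- Reading a polynomial off its coefficients on a box of exponents

≡ᵇ⇒≡ : ∀ {a x} → (a ≡ᵇ x) ≡ true → a ≡ x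
≡ᵇ⇒≡ {a} {x} a≡ᵇx = ℕₚ.≡ᵇ⇒≡ a x (subst T (sym a≡ᵇx) _)

≤ᵇ⇒≤ : ∀ {a b} → (a ≤ᵇ b) ≡ true → a ≤ b
≤ᵇ⇒≤ {a} {b} a≤ᵇb = ℕₚ.≤ᵇ⇒≤ a b (subst T (sym a≤ᵇb) _)

coeff-constP*P : ∀ a b c Q → coeff a b (constP c *P Q) ≡ c * coeff a b Q
coeff-constP*P a b c Q =
  trans (coeff-*P a b (constP c) Q) (trans (ℤₚ.+-identityʳ _) (∑-coeffₘ-·ₘ a b (c , 0 , 0) Q))

∑-upto-δ : ∀ A x v → ∑ (upto A) (λ a → if a ≡ᵇ x then v else 0ℤ) ≡ (if x ≤ᵇ A then v else 0ℤ)
∑-upto-δ zero    zero    v = ℤₚ.+-identityʳ v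
∑-upto-δ zero    (suc x) v = refl
∑-upto-δ (suc A) x       v =
  trans (∑-++ (upto A) (suc A ∷ []) _) (trans (cong (_+ last) (∑-upto-δ A x v)) (step x A))
  where
  last = (if suc A ≡ᵇ x then v else 0ℤ) + 0ℤ
  step : ∀ x A → (if x ≤ᵇ A then v else 0ℤ) + ((if suc A ≡ᵇ x then v else 0ℤ) + 0ℤ)
                 ≡ (if x ≤ᵇ suc A then v else 0ℤ)
  step zero          A       = ℤₚ.+-identityʳ v
  step (suc zero)    zero    = trans (ℤₚ.+-identityˡ _) (ℤₚ.+-identityʳ v)
  step (suc (suc x)) zero    = refl
  step (suc x)       (suc A) =
    trans (cong (λ B → (if B then v else 0ℤ) + ((if suc A ≡ᵇ x then v else 0ℤ) + 0ℤ)) (≤ᵇ-suc x A))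
          (trans (step x A) (cong (λ B → if B then v else 0ℤ) (sym (≤ᵇ-suc x (suc A)))))

inBox : ℕ → ℕ → Mono → Set
inBox A B p = degX p ≤ A × degY p ≤ B

∑-box-coeffₘ : ∀ A B (h : ℕ → ℕ → ℤ) p → inBox A B p →
  ∑ (upto A) (λ a → ∑ (upto B) (λ b → coeffₘ a b p * h a b)) ≡ cf p * h (degX p) (degY p)
∑-box-coeffₘ A B h (c , x , y) (x≤A , y≤B) = begin
  ∑ (upto A) (λ a → ∑ (upto B) (λ b → coeffₘ a b (c , x , y) * h a b))
    ≡⟨ ∑-cong (upto A) (λ a → ∑-cong (upto B) (λ b → coeffₘ-* a b)) ⟩
  ∑ (upto A) (λ a → ∑ (upto B) (λ b → if a ≡ᵇ x then (if b ≡ᵇ y then c * h x y else 0ℤ) else 0ℤ))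
    ≡⟨ ∑-cong (upto A) (λ a → ∑-if (upto B) (a ≡ᵇ x) _) ⟩
  ∑ (upto A) (λ a → if a ≡ᵇ x then ∑ (upto B) (λ b → if b ≡ᵇ y then c * h x y else 0ℤ) else 0ℤ)
    ≡⟨ ∑-upto-δ A x _ ⟩
  (if x ≤ᵇ A then ∑ (upto B) (λ b → if b ≡ᵇ y then c * h x y else 0ℤ) else 0ℤ)
    ≡⟨ cong (λ B → if B then _ else 0ℤ) (dec-true (x ℕ.≤? A) x≤A) ⟩
  ∑ (upto B) (λ b → if b ≡ᵇ y then c * h x y else 0ℤ)
    ≡⟨ ∑-upto-δ B y _ ⟩
  (if y ≤ᵇ B then c * h x y else 0ℤ)
    ≡⟨ cong (λ B → if B then _ else 0ℤ) (dec-true (y ℕ.≤? B) y≤B) ⟩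
  c * h x y ∎
  where
  open ≡-Reasoning
  coeffₘ-* : ∀ a b → coeffₘ a b (c , x , y) * h a b
                     ≡ (if a ≡ᵇ x then (if b ≡ᵇ y then c * h x y else 0ℤ) else 0ℤ)
  coeffₘ-* a b with a ≡ᵇ x in a≡x | b ≡ᵇ y in b≡y
  ... | true  | true  = cong₂ (λ u v → c * h u v) (≡ᵇ⇒≡ a≡x) (≡ᵇ⇒≡ b≡y)
  ... | true  | false = ℤₚ.*-zeroˡ (h a b)
  ... | false | _     = ℤₚ.*-zeroˡ (h a b)

∑-box-coeff : ∀ A B (h : ℕ → ℕ → ℤ) P → All (inBox A B) P →
  ∑ (upto A) (λ a → ∑ (upto B) (λ b → coeff a b P * h a b)) ≡ ∑ P (λ p → cf p * h (degX p) (degY p))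
∑-box-coeff A B h [] [] =
  ∑-zero (upto A) (λ a → ∑-zero (upto B) (λ b → ℤₚ.*-zeroˡ (h a b)))
∑-box-coeff A B h (p ∷ P) (p-in ∷ P-in) = begin
  ∑ (upto A) (λ a → ∑ (upto B) (λ b → (coeffₘ a b p + coeff a b P) * h a b))
    ≡⟨ ∑-cong (upto A) (λ a → trans (∑-cong (upto B) (λ b → ℤₚ.*-distribʳ-+ (h a b) (coeffₘ a b p) (coeff a b P)))
                                     (∑-+ (upto B) _ _)) ⟩
  ∑ (upto A) (λ a → ∑ (upto B) (λ b → coeffₘ a b p * h a b) + ∑ (upto B) (λ b → coeff a b P * h a b))
    ≡⟨ ∑-+ (upto A) _ _ ⟩
  ∑ (upto A) (λ a → ∑ (upto B) (λ b → coeffₘ a b p * h a b))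
    + ∑ (upto A) (λ a → ∑ (upto B) (λ b → coeff a b P * h a b))
    ≡⟨ cong₂ _+_ (∑-box-coeffₘ A B h p p-in) (∑-box-coeff A B h P P-in) ⟩
  cf p * h (degX p) (degY p) + ∑ P (λ p → cf p * h (degX p) (degY p)) ∎
  where open ≡-Reasoning

boxSum≈linExt : ∀ A B (K : ℕ → ℕ → Poly) P → All (inBox A B) P →
  ΣP (upto A) (λ a → ΣP (upto B) (λ b → constP (coeff a b P) *P K a b))
    ≈ linExt (λ p → constP (cf p) *P K (degX p) (degY p)) P
boxSum≈linExt A B K P P-in = mk≈ λ u v → begin
  coeff u v (ΣP (upto A) (λ a → ΣP (upto B) (λ b → constP (coeff a b P) *P K a b)))
    ≡⟨ trans (coeff-ΣP u v (upto A) _) (∑-cong (upto A) (λ a →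
         trans (coeff-ΣP u v (upto B) _) (∑-cong (upto B) (λ b → coeff-constP*P u v (coeff a b P) (K a b))))) ⟩
  ∑ (upto A) (λ a → ∑ (upto B) (λ b → coeff a b P * coeff u v (K a b)))
    ≡⟨ ∑-box-coeff A B (λ a b → coeff u v (K a b)) P P-in ⟩
  ∑ P (λ p → cf p * coeff u v (K (degX p) (degY p)))
    ≡⟨ trans (coeff-ΣP u v P _) (∑-cong P (λ p → coeff-constP*P u v (cf p) (K (degX p) (degY p)))) ⟨
  coeff u v (linExt (λ p → constP (cf p) *P K (degX p) (degY p)) P) ∎
  where open ≡-Reasoning

-- The substitution q ↦ 1 - p is a ring homomorphism

1-X : Poly
1-X = constP 1ℤ -P varX

substₘ : Mono → Poly
substₘ (c , a , b) = constP c *P 1-X ^P a *P varY ^P b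

subst1m-·ₘ : ∀ p q → substₘ (p ·ₘ q) ≈ substₘ p *P substₘ q
subst1m-·ₘ (c , a , b) (c′ , a′ , b′) = begin
  constP (c * c′) *P V ^P (a ℕ.+ a′) *P varY ^P (b ℕ.+ b′)
    ≈⟨ *P-cong (*P-congˡ (constP c *P constP c′) (^P-+ V a a′)) (^P-+ varY b b′) ⟩
  (constP c *P constP c′) *P (V ^P a *P V ^P a′) *P (varY ^P b *P varY ^P b′)
    ≈⟨ solve 6 (λ k k′ x x′ y y′ → (k ⊗ k′) ⊗ (x ⊗ x′) ⊗ (y ⊗ y′) ⊜ (k ⊗ x ⊗ y) ⊗ (k′ ⊗ x′ ⊗ y′)) ≈-refl
             (constP c) (constP c′) (V ^P a) (V ^P a′) (varY ^P b) (varY ^P b′) ⟩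
  substₘ (c , a , b) *P substₘ (c′ , a′ , b′) ∎
  where
  open ≈-Reasoning
  V = 1-X

subst1m-*P : ∀ P Q → subst1m (P *P Q) ≈ subst1m P *P subst1m Q
subst1m-*P P Q = linExt-*P substₘ substₘ substₘ P Q (All.universal (λ p → All.universal (subst1m-·ₘ p) Q) P)

subst1m-negP : ∀ P → subst1m (negP P) ≈ negP (subst1m P)
subst1m-negP = linExt-negP substₘ λ { (c , a , b) →
  solve 3 (λ k x y → (⊝ k) ⊗ x ⊗ y ⊜ ⊝ (k ⊗ x ⊗ y)) ≈-refl
        (constP c) (1-X ^P a) (varY ^P b) }

subst1m-+P : ∀ P Q → subst1m (P +P Q) ≈ subst1m P +P subst1m Q
subst1m-+P P Q = ΣP-++ P Q substₘ

subst1m-constP : ∀ c → subst1m (constP c) ≈ constP c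
subst1m-constP c = ≈-trans (+P-identityʳ _) (≈-trans (*P-identityʳ _) (*P-identityʳ (constP c)))

subst1m-^P : ∀ P n → subst1m (P ^P n) ≈ subst1m P ^P n
subst1m-^P P zero    = subst1m-constP 1ℤ
subst1m-^P P (suc n) = ≈-trans (subst1m-*P P (P ^P n)) (*P-congˡ (subst1m P) (subst1m-^P P n))

subst1m-varX : subst1m varX ≈ 1-X
subst1m-varX = ≈-trans (+P-identityʳ _)
  (≈-trans (*P-identityʳ _) (≈-trans (*P-identityˡ _) (*P-identityʳ 1-X)))

subst1m-varY : subst1m varY ≈ varY
subst1m-varY = ≈-trans (+P-identityʳ _)
  (≈-trans (*P-cong (*P-identityˡ (constP 1ℤ)) (*P-identityʳ varY)) (*P-identityˡ varY))

coeff--P : ∀ a b P Q → coeff a b (P -P Q) ≡ coeff a b P - coeff a b Q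
coeff--P a b P Q = trans (coeff-++ a b P (negP Q)) (cong (_+_ (coeff a b P)) (coeff-negP a b Q))

-P-cancel : ∀ P Q → P -P (P -P Q) ≈ Q
-P-cancel P Q = mk≈ λ a b → trans (coeff--P a b P (P -P Q))
  (trans (cong (_-_ (coeff a b P)) (coeff--P a b P Q)) (x-[x-y]≡y (coeff a b P) (coeff a b Q)))
  where
  x-[x-y]≡y : ∀ x y → x - (x - y) ≡ y
  x-[x-y]≡y = solve-∀

+P-cancelʳ : ∀ P Q → P +P Q -P Q ≈ P
+P-cancelʳ P Q = mk≈ λ a b → trans (coeff--P a b (P +P Q) Q)
  (trans (cong (_- coeff a b Q) (coeff-++ a b P Q)) (x+y-y≡x (coeff a b P) (coeff a b Q)))
  where
  x+y-y≡x : ∀ x y → x + y - y ≡ x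
  x+y-y≡x = solve-∀

1-[1-X] : constP 1ℤ -P 1-X ≈ varX
1-[1-X] = -P-cancel (constP 1ℤ) varX

subst1m-1-X : subst1m 1-X ≈ varX
subst1m-1-X = ≈-trans (subst1m-+P (constP 1ℤ) (negP varX))
  (≈-trans (+P-cong (subst1m-constP 1ℤ) (≈-trans (subst1m-negP varX) (negP-cong subst1m-varX))) 1-[1-X])

subst1m-XY+1-X-1-X : subst1m (varX *P varY +P 1-X) -P subst1m 1-X ≈ 1-X *P varY
subst1m-XY+1-X-1-X = begin
  subst1m (varX *P varY +P 1-X) -P subst1m 1-X
    ≈⟨ +P-cong (subst1m-+P (varX *P varY) 1-X) ≈-refl ⟩
  subst1m (varX *P varY) +P subst1m 1-X -P subst1m 1-X
    ≈⟨ +P-cancelʳ (subst1m (varX *P varY)) (subst1m 1-X) ⟩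
  subst1m (varX *P varY)
    ≈⟨ subst1m-*P varX varY ⟩
  subst1m varX *P subst1m varY
    ≈⟨ *P-cong subst1m-varX subst1m-varY ⟩
  1-X *P varY ∎
  where open ≈-Reasoning

-- Sums over subsets and the Möbius function of the Boolean lattice

∑ₛ : ∀ n → (Subset n → ℤ) → ℤ
∑ₛ n = ∑ (allSubsets n)

∑ₛ-split : ∀ n f → ∑ₛ (suc n) f ≡ ∑ₛ n (f ∘ (outside ∷_)) + ∑ₛ n (f ∘ (inside ∷_))
∑ₛ-split n f = trans (∑-++ (map (outside ∷_) (allSubsets n)) _ f)
                     (cong₂ _+_ (∑-map (allSubsets n) _ f) (∑-map (allSubsets n) _ f))

𝟙 : Bool → ℤ
𝟙 b = if b then 1ℤ else 0ℤ

δₛ : ∀ {n} → Subset n → Subset n → ℤ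
δₛ []            []            = 1ℤ
δₛ (outside ∷ T) (outside ∷ S) = δₛ T S
δₛ (outside ∷ T) (inside ∷ S)  = 0ℤ
δₛ (inside ∷ T)  (outside ∷ S) = 0ℤ
δₛ (inside ∷ T)  (inside ∷ S)  = δₛ T S

-- μ⊆ T V = (-1)^#(V ∖ T) if T ⊆ V, and 0 otherwise.
μ⊆ : ∀ {n} → Subset n → Subset n → ℤ
μ⊆ []            []            = 1ℤ
μ⊆ (outside ∷ T) (outside ∷ V) = μ⊆ T V
μ⊆ (inside ∷ T)  (outside ∷ V) = 0ℤ
μ⊆ (outside ∷ T) (inside ∷ V)  = - μ⊆ T V
μ⊆ (inside ∷ T)  (inside ∷ V)  = μ⊆ T V

∑-δₛ : ∀ n (S : Subset n) (g : Subset n → ℤ) → ∑ₛ n (λ T → δₛ T S * g T) ≡ g S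
∑-δₛ zero    []            g = trans (ℤₚ.+-identityʳ _) (ℤₚ.*-identityˡ _)
∑-δₛ (suc n) (outside ∷ S) g =
  trans (∑ₛ-split n _) (trans (cong₂ _+_ (∑-δₛ n S (g ∘ (outside ∷_))) (∑-zero (allSubsets n) (λ _ → refl)))
                              (ℤₚ.+-identityʳ _))
∑-δₛ (suc n) (inside ∷ S)  g =
  trans (∑ₛ-split n _) (trans (cong₂ _+_ (∑-zero (allSubsets n) (λ _ → refl)) (∑-δₛ n S (g ∘ (inside ∷_))))
                              (ℤₚ.+-identityˡ _))

∑-μ⊆ˡ : ∀ n (V : Subset n) → ∑ₛ n (λ T → μ⊆ T V) ≡ δₛ V ∅
∑-μ⊆ˡ zero    []            = refl
∑-μ⊆ˡ (suc n) (outside ∷ V) =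
  trans (∑ₛ-split n _) (trans (cong₂ _+_ (∑-μ⊆ˡ n V) (∑-zero (allSubsets n) (λ _ → refl))) (ℤₚ.+-identityʳ _))
∑-μ⊆ˡ (suc n) (inside ∷ V)  =
  trans (∑ₛ-split n _) (trans (cong (_+ ∑ₛ n (λ T → μ⊆ T V)) (∑-neg (allSubsets n) (λ T → μ⊆ T V)))
                              (ℤₚ.+-inverseˡ (∑ₛ n (λ T → μ⊆ T V))))

∑-⊆-μ⊆ : ∀ n (S U : Subset n) → ∑ₛ n (λ T → 𝟙 (does (T ⊆? S)) * μ⊆ U T) ≡ δₛ U S
∑-⊆-μ⊆ zero    []            []            = refl
∑-⊆-μ⊆ (suc n) (outside ∷ S) (outside ∷ U) =
  trans (∑ₛ-split n _) (trans (cong₂ _+_ (∑-⊆-μ⊆ n S U) (∑-zero (allSubsets n) (λ _ → refl))) (ℤₚ.+-identityʳ _))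
∑-⊆-μ⊆ (suc n) (outside ∷ S) (inside ∷ U)  =
  trans (∑ₛ-split n _) (cong₂ _+_ (∑-zero (allSubsets n) (λ T → ℤₚ.*-zeroʳ (𝟙 (does (T ⊆? S)))))
                                  (∑-zero (allSubsets n) (λ _ → refl)))
∑-⊆-μ⊆ (suc n) (inside ∷ S)  (outside ∷ U) =
  trans (∑ₛ-split n _) (trans (cong (_+_ s) (trans (∑-cong (allSubsets n) neg-term) (∑-neg (allSubsets n) _)))
                              (ℤₚ.+-inverseʳ s))
  where
  s = ∑ₛ n (λ T → 𝟙 (does (T ⊆? S)) * μ⊆ U T)
  neg-term : ∀ T → 𝟙 (does (T ⊆? S)) * - μ⊆ U T ≡ - (𝟙 (does (T ⊆? S)) * μ⊆ U T)
  neg-term T = sym (ℤₚ.neg-distribʳ-* (𝟙 (does (T ⊆? S))) (μ⊆ U T))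
∑-⊆-μ⊆ (suc n) (inside ∷ S)  (inside ∷ U)  =
  trans (∑ₛ-split n _) (trans (cong₂ _+_ (∑-zero (allSubsets n) (λ T → ℤₚ.*-zeroʳ (𝟙 (does (T ⊆? S)))))
                                         (∑-⊆-μ⊆ n S U))
                              (ℤₚ.+-identityˡ _))

μ⊆-support : ∀ {n} (T V : Subset n) → μ⊆ T V ≡ 0ℤ ⊎ T ⊆ V
μ⊆-support []            []            = inj₂ (λ x∈T → x∈T)
μ⊆-support (outside ∷ T) (outside ∷ V) = Sum.map₂ Subsetₚ.out⊆ (μ⊆-support T V)
μ⊆-support (inside ∷ T)  (outside ∷ V) = inj₁ refl
μ⊆-support (outside ∷ T) (inside ∷ V)  = Sum.map (cong (-_)) Subsetₚ.out⊆ (μ⊆-support T V)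
μ⊆-support (inside ∷ T)  (inside ∷ V)  = Sum.map₂ Subsetₚ.in⊆in (μ⊆-support T V)

μ⊆-∅ : ∀ {n} (T V : Subset n) → card V ≡ 0 → μ⊆ T V ≡ δₛ T V
μ⊆-∅ []            []            _       = refl
μ⊆-∅ (outside ∷ T) (outside ∷ V) ∣V∣≡0 = μ⊆-∅ T V ∣V∣≡0
μ⊆-∅ (inside ∷ T)  (outside ∷ V) _       = refl

𝟙-⊂ : ∀ {n} (T S : Subset n) → 𝟙 (does (T ⊂? S)) ≡ 𝟙 (does (T ⊆? S)) - δₛ T S
𝟙-⊂ []            []            = refl
𝟙-⊂ (outside ∷ T) (outside ∷ S) = 𝟙-⊂ T S
𝟙-⊂ (outside ∷ T) (inside ∷ S)  = sym (ℤₚ.+-identityʳ _)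
𝟙-⊂ (inside ∷ T)  (outside ∷ S) = refl
𝟙-⊂ (inside ∷ T)  (inside ∷ S)  = 𝟙-⊂ T S

μ⊆₁ : Bool → Bool → ℤ
μ⊆₁ outside outside = 1ℤ
μ⊆₁ inside  outside = 0ℤ
μ⊆₁ outside inside  = - 1ℤ
μ⊆₁ inside  inside  = 1ℤ

μ⊆-∷ : ∀ {n} t v (T V : Subset n) → μ⊆ (t ∷ T) (v ∷ V) ≡ μ⊆₁ t v * μ⊆ T V
μ⊆-∷ outside outside T V = sym (ℤₚ.*-identityˡ _)
μ⊆-∷ inside  outside T V = refl
μ⊆-∷ outside inside  T V = sym (ℤₚ.-1*i≡-i _)
μ⊆-∷ inside  inside  T V = sym (ℤₚ.*-identityˡ _)

-- Pairing T ∪ {e} with T ∖ {e} cancels the alternating sum.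
∑-μ⊆-toggle : ∀ n (V : Subset n) (e : Fin n) → lookup V e ≡ inside → (f : Subset n → ℤ) →
  (∀ T → f (T [ e ]≔ inside) ≡ f (T [ e ]≔ outside)) → ∑ₛ n (λ T → μ⊆ T V * f T) ≡ 0ℤ
∑-μ⊆-toggle (suc n) (inside ∷ V) zero refl f f-toggle = begin
  ∑ₛ (suc n) (λ T → μ⊆ T (inside ∷ V) * f T)
    ≡⟨ ∑ₛ-split n _ ⟩
  ∑ₛ n (λ T → - μ⊆ T V * f (outside ∷ T)) + ∑ₛ n (λ T → μ⊆ T V * f (inside ∷ T))
    ≡⟨ cong (_+ ∑ₛ n (λ T → μ⊆ T V * f (inside ∷ T)))
            (∑-cong (allSubsets n) (λ T → cong (λ x → - μ⊆ T V * x) (sym (f-toggle (outside ∷ T))))) ⟩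
  ∑ₛ n (λ T → - μ⊆ T V * f (inside ∷ T)) + ∑ₛ n (λ T → μ⊆ T V * f (inside ∷ T))
    ≡⟨ ∑-+ (allSubsets n) _ _ ⟨
  ∑ₛ n (λ T → - μ⊆ T V * f (inside ∷ T) + μ⊆ T V * f (inside ∷ T))
    ≡⟨ ∑-zero (allSubsets n) (λ T → neg*+* (μ⊆ T V) (f (inside ∷ T))) ⟩
  0ℤ ∎
  where
  open ≡-Reasoning
  neg*+* : ∀ a b → - a * b + a * b ≡ 0ℤ
  neg*+* = solve-∀
∑-μ⊆-toggle (suc n) (v ∷ V) (suc e) e∈V f f-toggle =
  trans (∑ₛ-split n _) (cong₂ _+_ (half outside) (half inside))
  where
  half : ∀ t → ∑ₛ n (λ T → μ⊆ (t ∷ T) (v ∷ V) * f (t ∷ T)) ≡ 0ℤ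
  half t = begin
    ∑ₛ n (λ T → μ⊆ (t ∷ T) (v ∷ V) * f (t ∷ T))
      ≡⟨ ∑-cong (allSubsets n) (λ T → trans (cong (_* f (t ∷ T)) (μ⊆-∷ t v T V)) (ℤₚ.*-assoc (μ⊆₁ t v) _ _)) ⟩
    ∑ₛ n (λ T → μ⊆₁ t v * (μ⊆ T V * f (t ∷ T)))
      ≡⟨ ∑-*ˡ (allSubsets n) (μ⊆₁ t v) _ ⟩
    μ⊆₁ t v * ∑ₛ n (λ T → μ⊆ T V * f (t ∷ T))
      ≡⟨ cong (μ⊆₁ t v *_) (∑-μ⊆-toggle n V e e∈V (f ∘ (t ∷_)) (f-toggle ∘ (t ∷_))) ⟩
    μ⊆₁ t v * 0ℤ
      ≡⟨ ℤₚ.*-zeroʳ (μ⊆₁ t v) ⟩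
    0ℤ ∎
    where open ≡-Reasoning

-- Expanding Σ_T f(T) x^#T (1 - x)^(n - #T) in powers of x

ΣPₛ : ∀ n → (Subset n → Poly) → Poly
ΣPₛ n = ΣP (allSubsets n)

ΣPₛ-split : ∀ n f → ΣPₛ (suc n) f ≈ ΣPₛ n (f ∘ (outside ∷_)) +P ΣPₛ n (f ∘ (inside ∷_))
ΣPₛ-split n f = ≈-trans (ΣP-++ (map (outside ∷_) (allSubsets n)) _ f)
                        (+P-cong (ΣP-map (allSubsets n) _ f) (ΣP-map (allSubsets n) _ f))

bernstein : ∀ n → Subset n → Poly
bernstein n T = varX ^P card T *P 1-X ^P (n ∸ card T)

bernsteinSum : ∀ n → (Subset n → Poly) → Poly
bernsteinSum n f = ΣPₛ n (λ T → f T *P bernstein n T)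

möbiusInner : ∀ n → (Subset n → Poly) → Subset n → Poly
möbiusInner n f V = ΣPₛ n (λ T → constP (μ⊆ T V) *P f T)

möbiusExpansion : ∀ n → (Subset n → Poly) → Poly
möbiusExpansion n f = ΣPₛ n (λ V → varX ^P card V *P möbiusInner n f V)

bernsteinSum-suc : ∀ n f →
  bernsteinSum (suc n) f ≈ 1-X *P bernsteinSum n (f ∘ (outside ∷_)) +P varX *P bernsteinSum n (f ∘ (inside ∷_))
bernsteinSum-suc n f = begin
  bernsteinSum (suc n) f
    ≈⟨ ΣPₛ-split n _ ⟩
  ΣPₛ n (λ T → f (outside ∷ T) *P bernstein (suc n) (outside ∷ T))
    +P ΣPₛ n (λ T → f (inside ∷ T) *P (varX *P varX ^P card T *P 1-X ^P (n ∸ card T)))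
    ≈⟨ +P-cong (ΣP-cong (allSubsets n) outside-term) (ΣP-cong (allSubsets n) inside-term) ⟩
  ΣPₛ n (λ T → 1-X *P (f (outside ∷ T) *P bernstein n T)) +P ΣPₛ n (λ T → varX *P (f (inside ∷ T) *P bernstein n T))
    ≈⟨ +P-cong (ΣP-*ˡ (allSubsets n) 1-X _) (ΣP-*ˡ (allSubsets n) varX _) ⟩
  1-X *P bernsteinSum n (f ∘ (outside ∷_)) +P varX *P bernsteinSum n (f ∘ (inside ∷_)) ∎
  where
  open ≈-Reasoning
  outside-term : ∀ T → f (outside ∷ T) *P bernstein (suc n) (outside ∷ T) ≈ 1-X *P (f (outside ∷ T) *P bernstein n T)
  outside-term T = ≈-trans (*P-congˡ (f (outside ∷ T)) (*P-congˡ (varX ^P card T)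
                             (≡⇒≈ (cong (1-X ^P_) (ℕₚ.+-∸-assoc 1 (Subsetₚ.∣p∣≤n T))))))
    (solve 4 (λ g x o r → g ⊗ (x ⊗ (o ⊗ r)) ⊜ o ⊗ (g ⊗ (x ⊗ r))) ≈-refl
           (f (outside ∷ T)) (varX ^P card T) 1-X (1-X ^P (n ∸ card T)))
  inside-term : ∀ T → f (inside ∷ T) *P (varX *P varX ^P card T *P 1-X ^P (n ∸ card T))
                      ≈ varX *P (f (inside ∷ T) *P bernstein n T)
  inside-term T = solve 4 (λ g x y r → g ⊗ ((x ⊗ y) ⊗ r) ⊜ x ⊗ (g ⊗ (y ⊗ r))) ≈-refl
                        (f (inside ∷ T)) varX (varX ^P card T) (1-X ^P (n ∸ card T))

möbiusInner-outside : ∀ n f V → möbiusInner (suc n) f (outside ∷ V) ≈ möbiusInner n (f ∘ (outside ∷_)) V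
möbiusInner-outside n f V = begin
  möbiusInner (suc n) f (outside ∷ V)
    ≈⟨ ΣPₛ-split n _ ⟩
  möbiusInner n (f ∘ (outside ∷_)) V +P ΣPₛ n (λ T → constP 0ℤ *P f (inside ∷ T))
    ≈⟨ +P-cong ≈-refl (≈-trans (ΣP-cong (allSubsets n) (λ T → 0*P (f (inside ∷ T)))) (ΣP-zero (allSubsets n))) ⟩
  möbiusInner n (f ∘ (outside ∷_)) V +P []
    ≈⟨ +P-identityʳ _ ⟩
  möbiusInner n (f ∘ (outside ∷_)) V ∎
  where
  open ≈-Reasoning
  0*P : ∀ Q → constP 0ℤ *P Q ≈ []
  0*P Q = mk≈ λ a b → trans (coeff-constP*P a b 0ℤ Q) (ℤₚ.*-zeroˡ (coeff a b Q))

möbiusInner-inside : ∀ n f V →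
  möbiusInner (suc n) f (inside ∷ V) ≈ negP (möbiusInner n (f ∘ (outside ∷_)) V) +P möbiusInner n (f ∘ (inside ∷_)) V
möbiusInner-inside n f V = ≈-trans (ΣPₛ-split n _) (+P-cong
  (≈-trans (ΣP-cong (allSubsets n) (λ T → solve 2 (λ c g → (⊝ c) ⊗ g ⊜ ⊝ (c ⊗ g)) ≈-refl (constP (μ⊆ T V)) (f (outside ∷ T))))
           (ΣP-neg (allSubsets n) _))
  ≈-refl)

möbiusExpansion-suc : ∀ n f → let R₀ = möbiusExpansion n (f ∘ (outside ∷_))
                                  R₁ = möbiusExpansion n (f ∘ (inside ∷_)) in
  möbiusExpansion (suc n) f ≈ R₀ +P varX *P (negP R₀ +P R₁)
möbiusExpansion-suc n f = begin
  möbiusExpansion (suc n) f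
    ≈⟨ ΣPₛ-split n _ ⟩
  ΣPₛ n (λ V → varX ^P card V *P möbiusInner (suc n) f (outside ∷ V))
    +P ΣPₛ n (λ V → (varX *P varX ^P card V) *P möbiusInner (suc n) f (inside ∷ V))
    ≈⟨ +P-cong (ΣP-cong (allSubsets n) (λ V → *P-congˡ (varX ^P card V) (möbiusInner-outside n f V)))
               (ΣP-cong (allSubsets n) inside-term) ⟩
  R₀ +P ΣPₛ n (λ V → varX *P (negP (varX ^P card V *P I₀ V) +P varX ^P card V *P I₁ V))
    ≈⟨ +P-cong (≈-refl {R₀}) (≈-trans (ΣP-*ˡ (allSubsets n) varX _)
                                (*P-congˡ varX (≈-trans (ΣP-+ (allSubsets n) _ _) (+P-cong (ΣP-neg (allSubsets n) _) ≈-refl)))) ⟩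
  R₀ +P varX *P (negP R₀ +P R₁) ∎
  where
  open ≈-Reasoning
  I₀ = möbiusInner n (f ∘ (outside ∷_))
  I₁ = möbiusInner n (f ∘ (inside ∷_))
  R₀ = möbiusExpansion n (f ∘ (outside ∷_))
  R₁ = möbiusExpansion n (f ∘ (inside ∷_))
  inside-term : ∀ V → (varX *P varX ^P card V) *P möbiusInner (suc n) f (inside ∷ V)
                      ≈ varX *P (negP (varX ^P card V *P I₀ V) +P varX ^P card V *P I₁ V)
  inside-term V = ≈-trans (*P-congˡ (varX *P varX ^P card V) (möbiusInner-inside n f V))
    (solve 4 (λ x y a b → (x ⊗ y) ⊗ (⊝ a ⊕ b) ⊜ x ⊗ (⊝ (y ⊗ a) ⊕ y ⊗ b)) ≈-refl varX (varX ^P card V) (I₀ V) (I₁ V))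

bernsteinSum≈möbiusExpansion : ∀ n f → bernsteinSum n f ≈ möbiusExpansion n f
bernsteinSum≈möbiusExpansion zero f = begin
  f [] *P (constP 1ℤ *P constP 1ℤ) +P []          ≈⟨ +P-identityʳ _ ⟩
  f [] *P (constP 1ℤ *P constP 1ℤ)                ≈⟨ *P-congˡ (f []) (*P-identityˡ _) ⟩
  f [] *P constP 1ℤ                               ≈⟨ *P-comm (f []) _ ⟩
  constP 1ℤ *P f []                               ≈⟨ +P-identityʳ _ ⟨
  constP 1ℤ *P f [] +P []                         ≈⟨ *P-identityˡ _ ⟨
  constP 1ℤ *P (constP 1ℤ *P f [] +P [])          ≈⟨ +P-identityʳ _ ⟨
  constP 1ℤ *P (constP 1ℤ *P f [] +P []) +P []    ∎
  where open ≈-Reasoning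
bernsteinSum≈möbiusExpansion (suc n) f = begin
  bernsteinSum (suc n) f
    ≈⟨ bernsteinSum-suc n f ⟩
  1-X *P bernsteinSum n (f ∘ (outside ∷_)) +P varX *P bernsteinSum n (f ∘ (inside ∷_))
    ≈⟨ +P-cong (*P-congˡ 1-X (bernsteinSum≈möbiusExpansion n _)) (*P-congˡ varX (bernsteinSum≈möbiusExpansion n _)) ⟩
  1-X *P R₀ +P varX *P R₁
    ≈⟨ solve 4 (λ o x r s → (o ⊕ ⊝ x) ⊗ r ⊕ x ⊗ s ⊜ (o ⊗ r ⊕ x ⊗ (⊝ r ⊕ s))) ≈-refl (constP 1ℤ) varX R₀ R₁ ⟩
  constP 1ℤ *P R₀ +P varX *P (negP R₀ +P R₁)
    ≈⟨ +P-cong (*P-identityˡ R₀) ≈-refl ⟩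
  R₀ +P varX *P (negP R₀ +P R₁)
    ≈⟨ möbiusExpansion-suc n f ⟨
  möbiusExpansion (suc n) f ∎
  where
  open ≈-Reasoning
  R₀ = möbiusExpansion n (f ∘ (outside ∷_))
  R₁ = möbiusExpansion n (f ∘ (inside ∷_))

varX^P : ∀ s → varX ^P s ≈ (1ℤ , s , 0) ∷ []
varX^P zero    = ≈-refl
varX^P (suc s) = *P-congˡ varX (varX^P s)

varY^P : ∀ e → varY ^P e ≈ (1ℤ , 0 , e) ∷ []
varY^P zero    = ≈-refl
varY^P (suc e) = *P-congˡ varY (varY^P e)

monomial : ∀ s c e → varX ^P s *P (constP c *P varY ^P e) ≈ (c , s , e) ∷ []
monomial s c e = ≈-trans (*P-cong (varX^P s) (*P-congˡ (constP c) (varY^P e))) (mk≈ λ a b →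
  cong (λ p → coeffₘ a b p + 0ℤ)
       (cong₂ _,_ (trans (ℤₚ.*-identityˡ _) (ℤₚ.*-identityʳ c)) (cong (_, e) (ℕₚ.+-identityʳ s))))

coeffₘ-𝟙 : ∀ k i c s e → coeffₘ k i (c , s , e) ≡ 𝟙 (k ≡ᵇ s) * (c * 𝟙 (i ≡ᵇ e))
coeffₘ-𝟙 k i c s e with k ≡ᵇ s | i ≡ᵇ e
... | true  | true  = sym (trans (ℤₚ.*-identityˡ _) (ℤₚ.*-identityʳ c))
... | true  | false = sym (trans (ℤₚ.*-identityˡ _) (ℤₚ.*-zeroʳ c))
... | false | _     = sym (ℤₚ.*-zeroˡ (c * 𝟙 (i ≡ᵇ e)))

coeff-möbiusExpansion : ∀ n (e : Subset n → ℕ) k i →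
  coeff k i (möbiusExpansion n (λ T → varY ^P e T))
    ≡ ∑ₛ n (λ V → 𝟙 (k ≡ᵇ card V) * ∑ₛ n (λ T → μ⊆ T V * 𝟙 (i ≡ᵇ e T)))
coeff-möbiusExpansion n e k i = trans (coeff-ΣP k i (allSubsets n) _) (∑-cong (allSubsets n) λ V → begin
  coeff k i (varX ^P card V *P ΣPₛ n (λ T → constP (μ⊆ T V) *P varY ^P e T))
    ≡⟨ coeff-≈ (ΣP-*ˡ (allSubsets n) (varX ^P card V) _) k i ⟨
  coeff k i (ΣPₛ n (λ T → varX ^P card V *P (constP (μ⊆ T V) *P varY ^P e T)))
    ≡⟨ coeff-≈ (ΣP-cong (allSubsets n) (λ T → monomial (card V) (μ⊆ T V) (e T))) k i ⟩
  coeff k i (ΣPₛ n (λ T → (μ⊆ T V , card V , e T) ∷ []))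
    ≡⟨ coeff-ΣP k i (allSubsets n) _ ⟩
  ∑ₛ n (λ T → coeffₘ k i (μ⊆ T V , card V , e T) + 0ℤ)
    ≡⟨ ∑-cong (allSubsets n) (λ T → trans (ℤₚ.+-identityʳ _) (coeffₘ-𝟙 k i (μ⊆ T V) (card V) (e T))) ⟩
  ∑ₛ n (λ T → 𝟙 (k ≡ᵇ card V) * (μ⊆ T V * 𝟙 (i ≡ᵇ e T)))
    ≡⟨ ∑-*ˡ (allSubsets n) (𝟙 (k ≡ᵇ card V)) _ ⟩
  𝟙 (k ≡ᵇ card V) * ∑ₛ n (λ T → μ⊆ T V * 𝟙 (i ≡ᵇ e T)) ∎)
  where open ≡-Reasoning

[]≔outside∪⁅⁆ : ∀ {n} (T : Subset n) e → (T [ e ]≔ outside) ∪ ⁅ e ⁆ ≡ T [ e ]≔ inside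
[]≔outside∪⁅⁆ (t ∷ T) zero    = cong (inside ∷_) (Subsetₚ.∪-identityʳ T)
[]≔outside∪⁅⁆ (t ∷ T) (suc e) = cong₂ _∷_ (Boolₚ.∨-identityʳ t) ([]≔outside∪⁅⁆ T e)

module MatroidProperties {m : ℕ} (M : Matroid m) where
  open Matroid M

  ρ≤rank : ∀ S → ρ S ≤ rank M
  ρ≤rank S = ρ-monotone Subsetₚ.⊆⊤

  σ⊤≡ : σ M ⊤ ≡ m ∸ rank M
  σ⊤≡ = cong (_∸ rank M) (Subsetₚ.∣⊤∣≡n m)

  rank≤∣∁∣+ρ : ∀ S → rank M ≤ (m ∸ card S) ℕ.+ ρ S
  rank≤∣∁∣+ρ S = begin
    rank M                      ≡⟨ cong ρ (Subsetₚ.p∪∁p≡⊤ S) ⟨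
    ρ (S ∪ ∁ S)                 ≤⟨ ℕₚ.m≤m+n _ _ ⟩
    ρ (S ∪ ∁ S) ℕ.+ ρ (S ∩ ∁ S) ≤⟨ ρ-submod S (∁ S) ⟩
    ρ S ℕ.+ ρ (∁ S)             ≤⟨ ℕₚ.+-monoʳ-≤ (ρ S) (ρ-bounded (∁ S)) ⟩
    ρ S ℕ.+ card (∁ S)          ≡⟨ cong (ρ S ℕ.+_) (Subsetₚ.∣∁p∣≡n∸∣p∣ S) ⟩
    ρ S ℕ.+ (m ∸ card S)        ≡⟨ ℕₚ.+-comm (ρ S) _ ⟩
    (m ∸ card S) ℕ.+ ρ S        ∎
    where open ℕₚ.≤-Reasoning

  σ≤σ⊤ : ∀ S → σ M S ≤ σ M ⊤
  σ≤σ⊤ S = begin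
    card S ∸ ρ S                   ≡⟨ cong (_∸ ρ S) (ℕₚ.m∸[m∸n]≡n (Subsetₚ.∣p∣≤n S)) ⟨
    (m ∸ (m ∸ card S)) ∸ ρ S       ≡⟨ ℕₚ.∸-+-assoc m (m ∸ card S) (ρ S) ⟩
    m ∸ ((m ∸ card S) ℕ.+ ρ S)     ≤⟨ ℕₚ.∸-monoʳ-≤ m (rank≤∣∁∣+ρ S) ⟩
    m ∸ rank M                     ≡⟨ σ⊤≡ ⟨
    σ M ⊤                          ∎
    where open ℕₚ.≤-Reasoning

  rank∸[rank∸ρ]+σ≡card : ∀ S → (rank M ∸ (rank M ∸ ρ S)) ℕ.+ σ M S ≡ card S
  rank∸[rank∸ρ]+σ≡card S = trans (cong (ℕ._+ σ M S) (ℕₚ.m∸[m∸n]≡n (ρ≤rank S))) (ℕₚ.m+[n∸m]≡n (ρ-bounded S))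

  rank∸ρ+σ⊤∸σ≡m∸card : ∀ S → (rank M ∸ ρ S) ℕ.+ (σ M ⊤ ∸ σ M S) ≡ m ∸ card S
  rank∸ρ+σ⊤∸σ≡m∸card S = begin
    (rank M ∸ ρ S) ℕ.+ (σ M ⊤ ∸ σ M S)     ≡⟨ ℕₚ.+-∸-assoc _ (σ≤σ⊤ S) ⟨
    ((rank M ∸ ρ S) ℕ.+ σ M ⊤) ∸ σ M S     ≡⟨ cong (λ x → ((rank M ∸ ρ S) ℕ.+ x) ∸ σ M S) σ⊤≡ ⟩
    ((rank M ∸ ρ S) ℕ.+ (m ∸ rank M)) ∸ σ M S ≡⟨ cong (_∸ σ M S) (ℕₚ.+-comm (rank M ∸ ρ S) _) ⟩
    ((m ∸ rank M) ℕ.+ (rank M ∸ ρ S)) ∸ σ M S ≡⟨ cong (_∸ σ M S) (ℕₚ.+-∸-assoc (m ∸ rank M) (ρ≤rank S)) ⟨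
    ((m ∸ rank M) ℕ.+ rank M ∸ ρ S) ∸ σ M S   ≡⟨ cong (λ x → (x ∸ ρ S) ∸ σ M S) (ℕₚ.m∸n+n≡m rank≤m) ⟩
    (m ∸ ρ S) ∸ σ M S                      ≡⟨ ℕₚ.∸-+-assoc m (ρ S) (σ M S) ⟩
    m ∸ (ρ S ℕ.+ σ M S)                    ≡⟨ cong (m ∸_) (ℕₚ.m+[n∸m]≡n (ρ-bounded S)) ⟩
    m ∸ card S                             ∎
    where
    open ≡-Reasoning
    rank≤m : rank M ≤ m
    rank≤m = subst (rank M ≤_) (Subsetₚ.∣⊤∣≡n m) (ρ-bounded ⊤)

  ρ-loop : ∀ e → ρ ⁅ e ⁆ ≡ 0 → ∀ T → ρ (T [ e ]≔ inside) ≡ ρ (T [ e ]≔ outside)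
  ρ-loop e ρe≡0 T = ℕₚ.≤-antisym ρT∪e≤ρT (ρ-monotone T⊆T∪e)
    where
    Tₒ = T [ e ]≔ outside
    T∪e≡ : Tₒ ∪ ⁅ e ⁆ ≡ T [ e ]≔ inside
    T∪e≡ = []≔outside∪⁅⁆ T e
    T⊆T∪e : Tₒ ⊆ T [ e ]≔ inside
    T⊆T∪e = subst (Tₒ ⊆_) T∪e≡ (Subsetₚ.p⊆p∪q ⁅ e ⁆)
    ρT∪e≤ρT : ρ (T [ e ]≔ inside) ≤ ρ Tₒ
    ρT∪e≤ρT = subst (λ U → ρ U ≤ ρ Tₒ) T∪e≡ (begin
      ρ (Tₒ ∪ ⁅ e ⁆)                    ≤⟨ ℕₚ.m≤m+n _ _ ⟩
      ρ (Tₒ ∪ ⁅ e ⁆) ℕ.+ ρ (Tₒ ∩ ⁅ e ⁆) ≤⟨ ρ-submod Tₒ ⁅ e ⁆ ⟩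
      ρ Tₒ ℕ.+ ρ ⁅ e ⁆                  ≡⟨ cong (ρ Tₒ ℕ.+_) ρe≡0 ⟩
      ρ Tₒ ℕ.+ 0                        ≡⟨ ℕₚ.+-identityʳ (ρ Tₒ) ⟩
      ρ Tₒ                              ∎)
      where open ℕₚ.≤-Reasoning

-- Y_M(1 - p, t) as a sum over subsets

module Y1mExpansion {m : ℕ} (M : Matroid m) where
  open Matroid M
  open MatroidProperties M
  open HomogenisationX using () renaming (homogenise to homogeniseX; homogenise-x-1^P to homogeniseX-x-1^P)
  open HomogenisationY using () renaming (homogenise to homogeniseY; homogenise-x-1^P to homogeniseY-y-1^P)

  private
    d = rank M
    σ⊤ = σ M ⊤
    U₁ = subst1m (varX *P varY +P 1-X)
    V₁ = subst1m 1-X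
    X₁ = subst1m varX

  clearedTerm : ℕ → ℕ → Poly
  clearedTerm a b = (U₁ ^P a *P V₁ ^P (d ∸ a)) *P X₁ ^P (σ⊤ ∸ b)

  Y1m≈boxSum : Y1m M ≈ ΣP (upto d) (λ a → ΣP (upto σ⊤) (λ b → constP (coeff a b (tutte M)) *P clearedTerm a b))
  Y1m≈boxSum = begin
    subst1m (sumP (concatMap (λ a → map (term a) (upto σ⊤)) (upto d)))
      ≈⟨ linExt-sumP substₘ (concatMap (λ a → map (term a) (upto σ⊤)) (upto d)) ⟩
    ΣP (concatMap (λ a → map (term a) (upto σ⊤)) (upto d)) subst1m
      ≈⟨ ΣP-concatMap (upto d) (λ a → map (term a) (upto σ⊤)) subst1m ⟩
    ΣP (upto d) (λ a → ΣP (map (term a) (upto σ⊤)) subst1m)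
      ≈⟨ ΣP-cong (upto d) (λ a → ≈-trans (ΣP-map (upto σ⊤) (term a) subst1m) (ΣP-cong (upto σ⊤) (subst1m-term a))) ⟩
    ΣP (upto d) (λ a → ΣP (upto σ⊤) (λ b → constP (coeff a b (tutte M)) *P clearedTerm a b)) ∎
    where
    open ≈-Reasoning
    term : ℕ → ℕ → Poly
    term a b = constP (coeff a b (tutte M)) *P (varX *P varY +P 1-X) ^P a *P 1-X ^P (d ∸ a) *P varX ^P (σ⊤ ∸ b)
    subst1m-term : ∀ a b → subst1m (term a b) ≈ constP (coeff a b (tutte M)) *P clearedTerm a b
    subst1m-term a b = begin
      subst1m (C *P Uₐ *P V *P X)
        ≈⟨ ≈-trans (subst1m-*P (C *P Uₐ *P V) X) (*P-congʳ (subst1m X) (≈-trans (subst1m-*P (C *P Uₐ) V)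
             (*P-congʳ (subst1m V) (subst1m-*P C Uₐ)))) ⟩
      subst1m C *P subst1m Uₐ *P subst1m V *P subst1m X
        ≈⟨ *P-cong (*P-cong (*P-cong (subst1m-constP (coeff a b (tutte M))) (subst1m-^P (varX *P varY +P 1-X) a))
                            (subst1m-^P 1-X (d ∸ a)))
                   (subst1m-^P varX (σ⊤ ∸ b)) ⟩
      C *P U₁ ^P a *P V₁ ^P (d ∸ a) *P X₁ ^P (σ⊤ ∸ b)
        ≈⟨ solve 4 (λ c u v x → c ⊗ u ⊗ v ⊗ x ⊜ c ⊗ ((u ⊗ v) ⊗ x)) ≈-refl
                 C (U₁ ^P a) (V₁ ^P (d ∸ a)) (X₁ ^P (σ⊤ ∸ b)) ⟩
      C *P clearedTerm a b ∎
      where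
      C = constP (coeff a b (tutte M))
      Uₐ = (varX *P varY +P 1-X) ^P a
      V = 1-X ^P (d ∸ a)
      X = varX ^P (σ⊤ ∸ b)

  tutteTerm : Subset m → Poly
  tutteTerm S = HomogenisationX.x-1 ^P (d ∸ ρ S) *P HomogenisationY.x-1 ^P σ M S

  tutte-inBox : All (inBox d σ⊤) (tutte M)
  tutte-inBox = All-sumP (map tutteTerm (allSubsets m)) (Allₚ.map⁺ (All.universal term-inBox (allSubsets m)))
    where
    term-inBox : ∀ S → All (inBox d σ⊤) (tutteTerm S)
    term-inBox S = All-*P _ _
      (All.zip (HomogenisationX.deg-x-1^P (d ∸ ρ S) , degY-x-1^P (d ∸ ρ S)))
      (All.zip (HomogenisationY.deg-x-1^P (σ M S) , degX-y-1^P (σ M S)))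
      λ { {p} {q} (x≤ , y≡0) (y≤ , x≡0) →
            subst (λ z → degX p ℕ.+ z ≤ d) (sym x≡0)
                  (ℕₚ.≤-trans (ℕₚ.≤-reflexive (ℕₚ.+-identityʳ _)) (ℕₚ.≤-trans x≤ (ℕₚ.m∸n≤m d (ρ S))))
          , subst (λ z → z ℕ.+ degY q ≤ σ⊤) (sym y≡0) (ℕₚ.≤-trans y≤ (σ≤σ⊤ S)) }

  clearedTermₘ : Mono → Poly
  clearedTermₘ p = constP (cf p) *P clearedTerm (degX p) (degY p)

  subsetTerm : Subset m → Poly
  subsetTerm S = ((U₁ -P V₁) ^P α *P V₁ ^P (d ∸ α)) *P ((constP 1ℤ -P X₁) ^P β *P X₁ ^P (σ⊤ ∸ β))
    where
    α = d ∸ ρ S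
    β = σ M S

  linExt-clearedTermₘ-tutteTerm : ∀ S → linExt clearedTermₘ (tutteTerm S) ≈ subsetTerm S
  linExt-clearedTermₘ-tutteTerm S = ≈-trans
    (linExt-*P clearedTermₘ (homogeniseX U₁ V₁ d) (homogeniseY (constP 1ℤ) X₁ σ⊤) _ _
               (All.map (λ {p} p-ok → All.map (λ {q} → clearedTermₘ-·ₘ {p} {q} p-ok) (degX-y-1^P (σ M S)))
                        (degY-x-1^P (d ∸ ρ S))))
    (*P-cong (homogeniseX-x-1^P U₁ V₁ d (d ∸ ρ S) (ℕₚ.m∸n≤m d (ρ S)))
             (homogeniseY-y-1^P (constP 1ℤ) X₁ σ⊤ (σ M S) (σ≤σ⊤ S)))
    where
    clearedTermₘ-·ₘ : ∀ {p q} → degY p ≡ 0 → degX q ≡ 0 →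
                      clearedTermₘ (p ·ₘ q) ≈ homogeniseX U₁ V₁ d p *P homogeniseY (constP 1ℤ) X₁ σ⊤ q
    clearedTermₘ-·ₘ {c , a , b} {c′ , a′ , b′} b≡0 a′≡0 = begin
      constP (c * c′) *P clearedTerm (a ℕ.+ a′) (b ℕ.+ b′)
        ≈⟨ ≡⇒≈ (cong₂ (λ x y → constP (c * c′) *P clearedTerm x y)
                      (trans (cong (a ℕ.+_) a′≡0) (ℕₚ.+-identityʳ a)) (cong (ℕ._+ b′) b≡0)) ⟩
      (constP c *P constP c′) *P ((U₁ ^P a *P V₁ ^P (d ∸ a)) *P X₁ ^P (σ⊤ ∸ b′))
        ≈⟨ solve 5 (λ k k′ u v x → (k ⊗ k′) ⊗ ((u ⊗ v) ⊗ x) ⊜ (k ⊗ (u ⊗ v)) ⊗ (k′ ⊗ x)) ≈-refl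
                 (constP c) (constP c′) (U₁ ^P a) (V₁ ^P (d ∸ a)) (X₁ ^P (σ⊤ ∸ b′)) ⟩
      homogeniseX U₁ V₁ d (c , a , b) *P (constP c′ *P X₁ ^P (σ⊤ ∸ b′))
        ≈⟨ *P-congˡ (homogeniseX U₁ V₁ d (c , a , b)) (*P-congˡ (constP c′)
             (≈-trans (*P-cong (1^P b′) ≈-refl) (*P-identityˡ (X₁ ^P (σ⊤ ∸ b′))))) ⟨
      homogeniseX U₁ V₁ d (c , a , b) *P homogeniseY (constP 1ℤ) X₁ σ⊤ (c′ , a′ , b′) ∎
      where open ≈-Reasoning

  subsetTerm≈bernstein : ∀ S → subsetTerm S ≈ varY ^P (d ∸ ρ S) *P bernstein m S
  subsetTerm≈bernstein S = begin
    ((U₁ -P V₁) ^P α *P V₁ ^P (d ∸ α)) *P ((constP 1ℤ -P X₁) ^P β *P X₁ ^P (σ⊤ ∸ β))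
      ≈⟨ *P-cong (*P-cong (^P-cong α subst1m-XY+1-X-1-X) (^P-cong (d ∸ α) subst1m-1-X))
                 (*P-cong (^P-cong β (+P-cong (≈-refl {constP 1ℤ}) (negP-cong subst1m-varX))) (^P-cong (σ⊤ ∸ β) subst1m-varX)) ⟩
    ((1-X *P varY) ^P α *P varX ^P (d ∸ α)) *P ((constP 1ℤ -P 1-X) ^P β *P 1-X ^P (σ⊤ ∸ β))
      ≈⟨ *P-cong (*P-cong (^P-*P 1-X varY α) ≈-refl) (*P-cong (^P-cong β 1-[1-X]) ≈-refl) ⟩
    ((1-X ^P α *P varY ^P α) *P varX ^P (d ∸ α)) *P (varX ^P β *P 1-X ^P (σ⊤ ∸ β))
      ≈⟨ solve 5 (λ a y x x′ b → ((a ⊗ y) ⊗ x) ⊗ (x′ ⊗ b) ⊜ y ⊗ ((x ⊗ x′) ⊗ (a ⊗ b))) ≈-refl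
               (1-X ^P α) (varY ^P α) (varX ^P (d ∸ α)) (varX ^P β) (1-X ^P (σ⊤ ∸ β)) ⟩
    varY ^P α *P ((varX ^P (d ∸ α) *P varX ^P β) *P (1-X ^P α *P 1-X ^P (σ⊤ ∸ β)))
      ≈⟨ *P-congˡ (varY ^P α) (*P-cong (^P-+ varX (d ∸ α) β) (^P-+ 1-X α (σ⊤ ∸ β))) ⟨
    varY ^P α *P (varX ^P ((d ∸ α) ℕ.+ β) *P 1-X ^P (α ℕ.+ (σ⊤ ∸ β)))
      ≈⟨ ≡⇒≈ (cong₂ (λ x y → varY ^P α *P (varX ^P x *P 1-X ^P y)) (rank∸[rank∸ρ]+σ≡card S) (rank∸ρ+σ⊤∸σ≡m∸card S)) ⟩
    varY ^P α *P bernstein m S ∎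
    where
    open ≈-Reasoning
    α = d ∸ ρ S
    β = σ M S

  Y1m≈bernsteinSum : Y1m M ≈ bernsteinSum m (λ S → varY ^P (d ∸ ρ S))
  Y1m≈bernsteinSum = begin
    Y1m M
      ≈⟨ Y1m≈boxSum ⟩
    ΣP (upto d) (λ a → ΣP (upto σ⊤) (λ b → constP (coeff a b (tutte M)) *P clearedTerm a b))
      ≈⟨ boxSum≈linExt d σ⊤ clearedTerm (tutte M) tutte-inBox ⟩
    linExt clearedTermₘ (sumP (map tutteTerm (allSubsets m)))
      ≈⟨ linExt-sumP clearedTermₘ (map tutteTerm (allSubsets m)) ⟩
    ΣP (map tutteTerm (allSubsets m)) (linExt clearedTermₘ)
      ≈⟨ ΣP-map (allSubsets m) tutteTerm (linExt clearedTermₘ) ⟩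
    ΣPₛ m (linExt clearedTermₘ ∘ tutteTerm)
      ≈⟨ ΣP-cong (allSubsets m) (λ S → ≈-trans (linExt-clearedTermₘ-tutteTerm S) (subsetTerm≈bernstein S)) ⟩
    bernsteinSum m (λ S → varY ^P (d ∸ ρ S)) ∎
    where open ≈-Reasoning

-- The Möbius function of an up-set of subsets with a new minimum adjoined

true≢false : true ≢ false
true≢false ()

module UpSetMöbius {n : ℕ} (F : Subset n → Bool)
  (F-up : ∀ {U T} → U ⊆ T → F U ≡ true → F T ≡ true) where

  möbius𝟙 : Subset n → ℤ
  möbius𝟙 S = ∑ₛ n (λ U → μ⊆ U S * 𝟙 (F U))

  möbius𝟙-outside : ∀ S → F S ≡ false → möbius𝟙 S ≡ 0ℤ
  möbius𝟙-outside S FS≡false = ∑-zero (allSubsets n) term≡0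
    where
    term≡0 : ∀ U → μ⊆ U S * 𝟙 (F U) ≡ 0ℤ
    term≡0 U with μ⊆-support U S | F U in FU
    ... | inj₁ μ≡0 | _     rewrite μ≡0 = refl
    ... | inj₂ U⊆S | false = ℤₚ.*-zeroʳ (μ⊆ U S)
    ... | inj₂ U⊆S | true  = ⊥-elim (true≢false (trans (sym (F-up U⊆S FU)) FS≡false))

  𝟙-up : ∀ U T → 𝟙 (F T) * (μ⊆ U T * 𝟙 (F U)) ≡ μ⊆ U T * 𝟙 (F U)
  𝟙-up U T with μ⊆-support U T | F U in FU
  ... | inj₁ μ≡0 | _     rewrite μ≡0 = ℤₚ.*-zeroʳ (𝟙 (F T))
  ... | inj₂ U⊆T | false = trans (cong (𝟙 (F T) *_) (ℤₚ.*-zeroʳ (μ⊆ U T)))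
                                 (trans (ℤₚ.*-zeroʳ (𝟙 (F T))) (sym (ℤₚ.*-zeroʳ (μ⊆ U T))))
  ... | inj₂ U⊆T | true  rewrite F-up U⊆T FU = ℤₚ.*-identityˡ _

  ∑-⊆-möbius𝟙 : ∀ S → F S ≡ true → ∑ₛ n (λ T → 𝟙 (does (T ⊆? S)) * (𝟙 (F T) * möbius𝟙 T)) ≡ 1ℤ
  ∑-⊆-möbius𝟙 S FS = begin
    ∑ₛ n (λ T → [ T ⊆S] * (𝟙 (F T) * möbius𝟙 T))
      ≡⟨ ∑-cong (allSubsets n) (λ T → trans (cong ([ T ⊆S] *_) (sym (∑-*ˡ (allSubsets n) (𝟙 (F T)) _)))
                                            (sym (∑-*ˡ (allSubsets n) [ T ⊆S] _))) ⟩
    ∑ₛ n (λ T → ∑ₛ n (λ U → [ T ⊆S] * (𝟙 (F T) * (μ⊆ U T * 𝟙 (F U)))))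
      ≡⟨ ∑-cong (allSubsets n) (λ T → ∑-cong (allSubsets n) (λ U → cong ([ T ⊆S] *_) (𝟙-up U T))) ⟩
    ∑ₛ n (λ T → ∑ₛ n (λ U → [ T ⊆S] * (μ⊆ U T * 𝟙 (F U))))
      ≡⟨ ∑-swap (allSubsets n) (allSubsets n) _ ⟩
    ∑ₛ n (λ U → ∑ₛ n (λ T → [ T ⊆S] * (μ⊆ U T * 𝟙 (F U))))
      ≡⟨ ∑-cong (allSubsets n) (λ U →
           trans (∑-cong (allSubsets n) (λ T → x*[y*z]≡z*[x*y] [ T ⊆S] (μ⊆ U T) (𝟙 (F U))))
                 (∑-*ˡ (allSubsets n) (𝟙 (F U)) _)) ⟩
    ∑ₛ n (λ U → 𝟙 (F U) * ∑ₛ n (λ T → [ T ⊆S] * μ⊆ U T))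
      ≡⟨ ∑-cong (allSubsets n) (λ U → trans (cong (𝟙 (F U) *_) (∑-⊆-μ⊆ n S U)) (ℤₚ.*-comm (𝟙 (F U)) _)) ⟩
    ∑ₛ n (λ U → δₛ U S * 𝟙 (F U))
      ≡⟨ ∑-δₛ n S (𝟙 ∘ F) ⟩
    𝟙 (F S)
      ≡⟨ cong 𝟙 FS ⟩
    1ℤ ∎
    where
    open ≡-Reasoning
    [_⊆S] : Subset n → ℤ
    [ T ⊆S] = 𝟙 (does (T ⊆? S))
    x*[y*z]≡z*[x*y] : ∀ x y z → x * (y * z) ≡ z * (x * y)
    x*[y*z]≡z*[x*y] = solve-∀

module MöbiusFunction {m : ℕ} (M : Matroid m) (i : ℕ) where
  open Matroid M

  inSi-up : ∀ {U T} → U ⊆ T → inSi M i U ≡ true → inSi M i T ≡ true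
  inSi-up {U} {T} U⊆T U∈Si =
    dec-true ((rank M ∸ i) ℕ.≤? ρ T) (ℕₚ.≤-trans (≤ᵇ⇒≤ U∈Si) (ρ-monotone U⊆T))

  open UpSetMöbius (inSi M i) inSi-up public

  μfuel≡ : ∀ fuel S → card S ≤ fuel → inSi M i S ≡ true → μfuel M i fuel S ≡ - möbius𝟙 S
  μfuel≡ zero    S ∣S∣≤0 S∈Si = cong -_ (sym (begin
    ∑ₛ m (λ U → μ⊆ U S * 𝟙 (inSi M i U))
      ≡⟨ ∑-cong (allSubsets m) (λ U → cong (_* 𝟙 (inSi M i U)) (μ⊆-∅ U S (ℕₚ.n≤0⇒n≡0 ∣S∣≤0))) ⟩
    ∑ₛ m (λ U → δₛ U S * 𝟙 (inSi M i U))
      ≡⟨ ∑-δₛ m S (𝟙 ∘ inSi M i) ⟩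
    𝟙 (inSi M i S)
      ≡⟨ cong 𝟙 S∈Si ⟩
    1ℤ ∎))
    where open ≡-Reasoning
  μfuel≡ (suc fuel) S ∣S∣≤1+fuel S∈Si = begin
    - (1ℤ + ∑ (filterᵇ (λ T → inSi M i T ∧ does (T ⊂? S)) (allSubsets m)) (μfuel M i fuel))
      ≡⟨ cong (λ x → - (1ℤ + x)) (∑-filterᵇ _ (μfuel M i fuel) (allSubsets m)) ⟩
    - (1ℤ + ∑ₛ m (λ T → if inSi M i T ∧ does (T ⊂? S) then μfuel M i fuel T else 0ℤ))
      ≡⟨ cong (λ x → - (1ℤ + x)) (trans (∑-cong (allSubsets m) below) (∑-neg (allSubsets m) _)) ⟩
    - (1ℤ + - ∑ₛ m (λ T → 𝟙 (does (T ⊂? S)) * B T))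
      ≡⟨ cong (λ x → - (1ℤ + - x)) ∑-⊂ ⟩
    - (1ℤ + - (1ℤ - möbius𝟙 S))
      ≡⟨ -[1+-[1-x]]≡-x (möbius𝟙 S) ⟩
    - möbius𝟙 S ∎
    where
    open ≡-Reasoning
    B : Subset m → ℤ
    B T = 𝟙 (inSi M i T) * möbius𝟙 T
    below : ∀ T → (if inSi M i T ∧ does (T ⊂? S) then μfuel M i fuel T else 0ℤ) ≡ - (𝟙 (does (T ⊂? S)) * B T)
    below T with inSi M i T in T∈Si | T ⊂? S
    ... | false | T⊂?S     = sym (cong -_ (ℤₚ.*-zeroʳ (𝟙 (does T⊂?S))))
    ... | true  | no  _    = refl
    ... | true  | yes T⊂S  = trans
      (μfuel≡ fuel T (ℕₚ.≤-pred (ℕₚ.≤-trans (Subsetₚ.p⊂q⇒∣p∣<∣q∣ T⊂S) ∣S∣≤1+fuel)) T∈Si)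
      (cong -_ (sym (trans (ℤₚ.*-identityˡ _) (ℤₚ.*-identityˡ _))))
    [x-y]*z≡x*z-y*z : ∀ x y z → (x - y) * z ≡ x * z - y * z
    [x-y]*z≡x*z-y*z = solve-∀
    ∑-⊂ : ∑ₛ m (λ T → 𝟙 (does (T ⊂? S)) * B T) ≡ 1ℤ - möbius𝟙 S
    ∑-⊂ = begin
      ∑ₛ m (λ T → 𝟙 (does (T ⊂? S)) * B T)
        ≡⟨ ∑-cong (allSubsets m) (λ T → trans (cong (_* B T) (𝟙-⊂ T S)) ([x-y]*z≡x*z-y*z (𝟙 (does (T ⊆? S))) (δₛ T S) (B T))) ⟩
      ∑ₛ m (λ T → 𝟙 (does (T ⊆? S)) * B T - δₛ T S * B T)
        ≡⟨ ∑-sub (allSubsets m) _ _ ⟩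
      ∑ₛ m (λ T → 𝟙 (does (T ⊆? S)) * B T) - ∑ₛ m (λ T → δₛ T S * B T)
        ≡⟨ cong₂ _-_ (∑-⊆-möbius𝟙 S S∈Si) (∑-δₛ m S B) ⟩
      1ℤ - 𝟙 (inSi M i S) * möbius𝟙 S
        ≡⟨ cong (λ b → 1ℤ - 𝟙 b * möbius𝟙 S) S∈Si ⟩
      1ℤ - 1ℤ * möbius𝟙 S
        ≡⟨ cong (_-_ 1ℤ) (ℤₚ.*-identityˡ (möbius𝟙 S)) ⟩
      1ℤ - möbius𝟙 S ∎
    -[1+-[1-x]]≡-x : ∀ x → - (1ℤ + - (1ℤ - x)) ≡ - x
    -[1+-[1-x]]≡-x = solve-∀

  μ≡-möbius𝟙 : ∀ S → inSi M i S ≡ true → μ M i S ≡ - möbius𝟙 S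
  μ≡-möbius𝟙 S = μfuel≡ (card S) S ℕₚ.≤-refl

-- The coefficients of Y_M(1 - p, t)

parity-suc : ∀ n → parity (suc n) ≡ - parity n
parity-suc zero    = refl
parity-suc (suc n) = sym (trans (cong -_ (parity-suc n)) (ℤₚ.neg-involutive (parity n)))

parity-sq : ∀ n → parity n * parity n ≡ 1ℤ
parity-sq zero          = refl
parity-sq (suc zero)    = refl
parity-sq (suc (suc n)) = parity-sq n

signℤ-sq : ∀ x → signℤ x * signℤ x ≡ 1ℤ
signℤ-sq x = parity-sq ℤ.∣ x ∣

signℤ-*-signℤ-suc : ∀ x → signℤ x * signℤ (x + 1ℤ) ≡ - 1ℤ
signℤ-*-signℤ-suc (+ n) = begin
  parity n * parity (n ℕ.+ 1) ≡⟨ cong (λ x → parity n * parity x) (ℕₚ.+-comm n 1) ⟩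
  parity n * parity (suc n)   ≡⟨ cong (parity n *_) (parity-suc n) ⟩
  parity n * - parity n       ≡⟨ ℤₚ.neg-distribʳ-* (parity n) (parity n) ⟨
  - (parity n * parity n)     ≡⟨ cong -_ (parity-sq n) ⟩
  - 1ℤ                        ∎
  where open ≡-Reasoning
signℤ-*-signℤ-suc -[1+ n ] = begin
  parity (suc n) * parity ℤ.∣ - (+ suc n) + 1ℤ ∣ ≡⟨ cong (λ x → parity (suc n) * parity x) ∣-[1+n]+1∣≡n ⟩
  parity (suc n) * parity n                       ≡⟨ cong (_* parity n) (parity-suc n) ⟩
  - parity n * parity n                           ≡⟨ ℤₚ.neg-distribˡ-* (parity n) (parity n) ⟨
  - (parity n * parity n)                         ≡⟨ cong -_ (parity-sq n) ⟩
  - 1ℤ                                            ∎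
  where
  open ≡-Reasoning
  -[1+y]+1≡-y : ∀ y → - (1ℤ + y) + 1ℤ ≡ - y
  -[1+y]+1≡-y = solve-∀
  ∣-[1+n]+1∣≡n : ℤ.∣ - (+ suc n) + 1ℤ ∣ ≡ n
  ∣-[1+n]+1∣≡n = trans (cong ℤ.∣_∣ (-[1+y]+1≡-y (+ n))) (ℤₚ.∣-i∣≡∣i∣ (+ n))

≤ᵇ-false : ∀ {a b} → b < a → (a ≤ᵇ b) ≡ false
≤ᵇ-false {a} {b} b<a = dec-false (a ℕ.≤? b) (ℕₚ.<⇒≱ b<a)

if-guard : ∀ {b₁ b₂ b₄ : Bool} b₃ {x : ℤ} → b₁ ≡ true → b₂ ≡ true → b₄ ≡ true →
           (if b₁ ∧ b₂ ∧ b₃ ∧ b₄ then x else 0ℤ) ≡ (if b₃ then x else 0ℤ)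
if-guard true  refl refl refl = refl
if-guard false refl refl refl = refl

1≰-x : ∀ x → ¬ (1ℤ ℤ.≤ - (+ x))
1≰-x zero    (ℤ.+≤+ ())
1≰-x (suc x) ()

n≰n∸1 : ∀ n → 1 ≤ n → ¬ (n ≤ n ∸ 1)
n≰n∸1 (suc n) _ = ℕₚ.1+n≰n

count : ∀ {n} → (Fin n → Bool) → ℕ
count {n} P = len (filterᵇ P (allFin n))

length-filterᵇ-tabulate : ∀ {A : Set} n (f : Fin n → A) (P : A → Bool) →
                          len (filterᵇ P (tabulate f)) ≡ count (P ∘ f)
length-filterᵇ-tabulate zero    f P = refl
length-filterᵇ-tabulate (suc n) f P with P (f zero)
... | true  = cong suc tail≡
  where tail≡ = trans (length-filterᵇ-tabulate n (f ∘ suc) P) (sym (length-filterᵇ-tabulate n suc (P ∘ f)))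
... | false = trans (length-filterᵇ-tabulate n (f ∘ suc) P) (sym (length-filterᵇ-tabulate n suc (P ∘ f)))

pigeonhole : ∀ n (V : Subset n) (P : Fin n → Bool) →
             (∃ λ e → lookup V e ≡ inside × P e ≡ true) ⊎ card V ℕ.+ count P ≤ n
pigeonhole zero    []      P = inj₂ z≤n
pigeonhole (suc n) (v ∷ V) P with pigeonhole n V (P ∘ suc)
... | inj₁ (e , e∈V , Pe) = inj₁ (suc e , e∈V , Pe)
... | inj₂ bound =
  extend v (P zero) refl (subst (λ c → card V ℕ.+ c ≤ n) (sym (length-filterᵇ-tabulate n suc P)) bound)
  where
  extend : ∀ v b → P zero ≡ b → card V ℕ.+ len (filterᵇ P (tabulate suc)) ≤ n →
           (∃ λ e → lookup (v ∷ V) e ≡ inside × P e ≡ true) ⊎ card (v ∷ V) ℕ.+ count P ≤ suc n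
  extend inside  true  P0 _     = inj₁ (zero , refl , P0)
  extend inside  false P0 bound rewrite P0 = inj₂ (s≤s bound)
  extend outside true  P0 bound rewrite P0 =
    inj₂ (subst (_≤ suc n) (sym (ℕₚ.+-suc (card V) _)) (s≤s bound))
  extend outside false P0 bound rewrite P0 = inj₂ (ℕₚ.m≤n⇒m≤1+n bound)

module Coefficients {m : ℕ} (M : Matroid m) where
  open Matroid M
  open MatroidProperties M
  open Y1mExpansion M using (Y1m≈bernsteinSum)

  private
    d = rank M

  rankSum≥ : ℕ → ℕ → ℤ
  rankSum≥ r k = ∑ₛ m (λ V → 𝟙 (k ≡ᵇ card V) * ∑ₛ m (λ T → μ⊆ T V * 𝟙 (r ≤ᵇ ρ T)))

  coeff-Y1m : ∀ k i →
    coeff k i (Y1m M) ≡ ∑ₛ m (λ V → 𝟙 (k ≡ᵇ card V) * ∑ₛ m (λ T → μ⊆ T V * 𝟙 (i ≡ᵇ d ∸ ρ T)))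
  coeff-Y1m k i = trans (coeff-≈ (≈-trans Y1m≈bernsteinSum (bernsteinSum≈möbiusExpansion m _)) k i)
                        (coeff-möbiusExpansion m (λ T → d ∸ ρ T) k i)

  𝟙-≡ᵇ : ∀ r x → 𝟙 (r ≡ᵇ x) ≡ 𝟙 (r ≤ᵇ x) - 𝟙 (suc r ≤ᵇ x)
  𝟙-≡ᵇ zero    zero    = refl
  𝟙-≡ᵇ zero    (suc x) = refl
  𝟙-≡ᵇ (suc r) zero    = refl
  𝟙-≡ᵇ (suc r) (suc x) =
    trans (𝟙-≡ᵇ r x) (cong₂ (λ a b → 𝟙 a - 𝟙 b) (sym (≤ᵇ-suc r x)) (sym (≤ᵇ-suc (suc r) x)))

  ≡ᵇ-rank∸ : ∀ i T → i ≤ d → (i ≡ᵇ d ∸ ρ T) ≡ (d ∸ i ≡ᵇ ρ T)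
  ≡ᵇ-rank∸ i T i≤d = does-⇔ (mk⇔ (λ i≡ → trans (cong (d ∸_) i≡) (ℕₚ.m∸[m∸n]≡n (ρ≤rank T)))
                                 (λ ≡ρ → trans (sym (ℕₚ.m∸[m∸n]≡n i≤d)) (cong (d ∸_) ≡ρ)))
                            (i ℕ.≟ d ∸ ρ T) (d ∸ i ℕ.≟ ρ T)

  coeff-Y1m≡rankSum≥ : ∀ k i → i ≤ d → coeff k i (Y1m M) ≡ rankSum≥ (d ∸ i) k - rankSum≥ (suc (d ∸ i)) k
  coeff-Y1m≡rankSum≥ k i i≤d = begin
    coeff k i (Y1m M)
      ≡⟨ coeff-Y1m k i ⟩
    ∑ₛ m (λ V → 𝟙 (k ≡ᵇ card V) * ∑ₛ m (λ T → μ⊆ T V * 𝟙 (i ≡ᵇ d ∸ ρ T)))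
      ≡⟨ ∑-cong (allSubsets m) (λ V → trans (cong (𝟙 (k ≡ᵇ card V) *_) (inner V)) (x*[y-z]≡x*y-x*z (𝟙 (k ≡ᵇ card V)) _ _)) ⟩
    ∑ₛ m (λ V → 𝟙 (k ≡ᵇ card V) * ∑ₛ m (λ T → μ⊆ T V * 𝟙 (r ≤ᵇ ρ T))
              - 𝟙 (k ≡ᵇ card V) * ∑ₛ m (λ T → μ⊆ T V * 𝟙 (suc r ≤ᵇ ρ T)))
      ≡⟨ ∑-sub (allSubsets m) _ _ ⟩
    rankSum≥ r k - rankSum≥ (suc r) k ∎
    where
    open ≡-Reasoning
    r = d ∸ i
    x*[y-z]≡x*y-x*z : ∀ x y z → x * (y - z) ≡ x * y - x * z
    x*[y-z]≡x*y-x*z = solve-∀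
    inner : ∀ V → ∑ₛ m (λ T → μ⊆ T V * 𝟙 (i ≡ᵇ d ∸ ρ T))
                  ≡ ∑ₛ m (λ T → μ⊆ T V * 𝟙 (r ≤ᵇ ρ T)) - ∑ₛ m (λ T → μ⊆ T V * 𝟙 (suc r ≤ᵇ ρ T))
    inner V = trans (∑-cong (allSubsets m) (λ T → begin
        μ⊆ T V * 𝟙 (i ≡ᵇ d ∸ ρ T)                             ≡⟨ cong (λ b → μ⊆ T V * 𝟙 b) (≡ᵇ-rank∸ i T i≤d) ⟩
        μ⊆ T V * 𝟙 (r ≡ᵇ ρ T)                                 ≡⟨ cong (μ⊆ T V *_) (𝟙-≡ᵇ r (ρ T)) ⟩
        μ⊆ T V * (𝟙 (r ≤ᵇ ρ T) - 𝟙 (suc r ≤ᵇ ρ T))            ≡⟨ x*[y-z]≡x*y-x*z (μ⊆ T V) _ _ ⟩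
        μ⊆ T V * 𝟙 (r ≤ᵇ ρ T) - μ⊆ T V * 𝟙 (suc r ≤ᵇ ρ T)    ∎))
      (∑-sub (allSubsets m) _ _)

  rankSum≥-vanishes : ∀ r k → (∀ V T → card V ≡ k → T ⊆ V → ρ T < r) → rankSum≥ r k ≡ 0ℤ
  rankSum≥-vanishes r k ρ<r = ∑-zero (allSubsets m) V-term
    where
    V-term : ∀ V → 𝟙 (k ≡ᵇ card V) * ∑ₛ m (λ T → μ⊆ T V * 𝟙 (r ≤ᵇ ρ T)) ≡ 0ℤ
    V-term V with k ≡ᵇ card V in k≡∣V∣
    ... | false = refl
    ... | true  = cong (1ℤ *_) (∑-zero (allSubsets m) T-term)
      where
      T-term : ∀ T → μ⊆ T V * 𝟙 (r ≤ᵇ ρ T) ≡ 0ℤ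
      T-term T with μ⊆-support T V
      ... | inj₁ μ≡0 rewrite μ≡0 = refl
      ... | inj₂ T⊆V rewrite ≤ᵇ-false (ρ<r V T (sym (≡ᵇ⇒≡ k≡∣V∣)) T⊆V) = ℤₚ.*-zeroʳ (μ⊆ T V)

  rankSum≥-above-rank : ∀ k → rankSum≥ (suc d) k ≡ 0ℤ
  rankSum≥-above-rank k = rankSum≥-vanishes (suc d) k (λ _ T _ _ → s≤s (ρ≤rank T))

  rankSum≥-zero : ∀ k → rankSum≥ 0 k ≡ δ k 0
  rankSum≥-zero k = begin
    ∑ₛ m (λ V → 𝟙 (k ≡ᵇ card V) * ∑ₛ m (λ T → μ⊆ T V * 1ℤ))
      ≡⟨ ∑-cong (allSubsets m) (λ V → trans (cong (𝟙 (k ≡ᵇ card V) *_) (∑-μ⊆ V)) (ℤₚ.*-comm _ (δₛ V ∅))) ⟩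
    ∑ₛ m (λ V → δₛ V ∅ * 𝟙 (k ≡ᵇ card V))
      ≡⟨ ∑-δₛ m ∅ _ ⟩
    𝟙 (k ≡ᵇ card (∅ {m}))
      ≡⟨ cong (λ c → 𝟙 (k ≡ᵇ c)) (Subsetₚ.∣⊥∣≡0 m) ⟩
    δ k 0 ∎
    where
    open ≡-Reasoning
    ∑-μ⊆ : ∀ V → ∑ₛ m (λ T → μ⊆ T V * 1ℤ) ≡ δₛ V ∅
    ∑-μ⊆ V = trans (∑-cong (allSubsets m) (λ T → ℤₚ.*-identityʳ (μ⊆ T V))) (∑-μ⊆ˡ m V)

  ωIndex : ℕ → ℕ → ℤ
  ωIndex i s = + s - + d + 1ℤ + + i

  μSum : ℕ → ℤ → ℤ
  μSum i j = ∑ (filterᵇ (λ S → inSi M i S ∧ does (ωIndex i (card S) ℤ.≟ j)) (allSubsets m)) (μ M i)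

  ωIndex≡⊖ : ∀ i s → ωIndex i s ≡ (s ℕ.+ suc i) ⊖ d
  ωIndex≡⊖ i s = begin
    + s - + d + 1ℤ + + i   ≡⟨ x-y+1+z≡x+[1+z]-y (+ s) (+ d) (+ i) ⟩
    + s + + suc i - + d    ≡⟨ cong (_- + d) (ℤₚ.pos-+ s (suc i)) ⟨
    + (s ℕ.+ suc i) - + d  ≡⟨ ℤₚ.m-n≡m⊖n (s ℕ.+ suc i) d ⟩
    (s ℕ.+ suc i) ⊖ d      ∎
    where
    open ≡-Reasoning
    x-y+1+z≡x+[1+z]-y : ∀ x y z → x - y + 1ℤ + z ≡ x + (1ℤ + z) - y
    x-y+1+z≡x+[1+z]-y = solve-∀

  ≟-ωIndex : ∀ i s k → does (ωIndex i s ℤ.≟ ωIndex i k) ≡ (k ≡ᵇ s)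
  ≟-ωIndex i s k = does-⇔ (mk⇔ (λ eq → sym (ωIndex-injective eq)) (λ k≡s → cong (ωIndex i) (sym k≡s)))
                          (ωIndex i s ℤ.≟ ωIndex i k) (k ℕ.≟ s)
    where
    x-y+1+z+[y-1-z]≡x : ∀ x y z → x - y + 1ℤ + z + (y - 1ℤ - z) ≡ x
    x-y+1+z+[y-1-z]≡x = solve-∀
    ωIndex-injective : ∀ {s s′} → ωIndex i s ≡ ωIndex i s′ → s ≡ s′
    ωIndex-injective {s} {s′} eq = ℤₚ.+-injective (begin
      + s                                   ≡⟨ x-y+1+z+[y-1-z]≡x (+ s) (+ d) (+ i) ⟨
      ωIndex i s + (+ d - 1ℤ - + i)         ≡⟨ cong (_+ (+ d - 1ℤ - + i)) eq ⟩
      ωIndex i s′ + (+ d - 1ℤ - + i)        ≡⟨ x-y+1+z+[y-1-z]≡x (+ s′) (+ d) (+ i) ⟩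
      + s′                                  ∎)
      where open ≡-Reasoning

  μSum≡-rankSum≥ : ∀ i k → μSum i (ωIndex i k) ≡ - rankSum≥ (d ∸ i) k
  μSum≡-rankSum≥ i k = begin
    μSum i (ωIndex i k)
      ≡⟨ ∑-filterᵇ _ (μ M i) (allSubsets m) ⟩
    ∑ₛ m (λ S → if inSi M i S ∧ does (ωIndex i (card S) ℤ.≟ ωIndex i k) then μ M i S else 0ℤ)
      ≡⟨ ∑-cong (allSubsets m) term ⟩
    ∑ₛ m (λ S → - (𝟙 (k ≡ᵇ card S) * möbius𝟙 S))
      ≡⟨ ∑-neg (allSubsets m) _ ⟩
    - rankSum≥ (d ∸ i) k ∎
    where
    open ≡-Reasoning
    open MöbiusFunction M i
    term : ∀ S → (if inSi M i S ∧ does (ωIndex i (card S) ℤ.≟ ωIndex i k) then μ M i S else 0ℤ)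
                 ≡ - (𝟙 (k ≡ᵇ card S) * möbius𝟙 S)
    term S rewrite ≟-ωIndex i (card S) k with inSi M i S in S∈Si | k ≡ᵇ card S
    ... | false | b     = sym (trans (cong (λ x → - (𝟙 b * x)) (möbius𝟙-outside S S∈Si)) (cong -_ (ℤₚ.*-zeroʳ (𝟙 b))))
    ... | true  | true  = trans (μ≡-möbius𝟙 S S∈Si) (cong -_ (sym (ℤₚ.*-identityˡ (möbius𝟙 S))))
    ... | true  | false = refl

  ωIndex-monoʳ-≤ : ∀ i {k k′} → k ≤ k′ → ωIndex i k ℤ.≤ ωIndex i k′
  ωIndex-monoʳ-≤ i {k} {k′} k≤k′ =
    subst₂ ℤ._≤_ (sym (ωIndex≡⊖ i k)) (sym (ωIndex≡⊖ i k′)) (ℤₚ.⊖-monoˡ-≤ d (ℕₚ.+-monoˡ-≤ (suc i) k≤k′))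

  1≤ωIndex : ∀ {i k} → d ≤ k ℕ.+ i → 1ℤ ℤ.≤ ωIndex i k
  1≤ωIndex {i} {k} d≤k+i = subst (1ℤ ℤ.≤_) (sym (trans (ωIndex≡⊖ i k) (ℤₚ.⊖-≥ (ℕₚ.<⇒≤ d<k+1+i))))
                                 (ℤ.+≤+ (ℕₚ.m<n⇒0<n∸m d<k+1+i))
    where d<k+1+i = ℕₚ.≤-trans (s≤s d≤k+i) (ℕₚ.≤-reflexive (sym (ℕₚ.+-suc k i)))

  k+1+i≤rank : ∀ {i k} → ¬ d ≤ k ℕ.+ i → k ℕ.+ suc i ≤ d
  k+1+i≤rank {i} {k} d≰k+i = ℕₚ.≤-trans (ℕₚ.≤-reflexive (ℕₚ.+-suc k i)) (ℕₚ.≰⇒> d≰k+i)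

  1≰ωIndex : ∀ {i k} → ¬ d ≤ k ℕ.+ i → ¬ (1ℤ ℤ.≤ ωIndex i k)
  1≰ωIndex {i} {k} d≰k+i 1≤j =
    1≰-x (d ∸ (k ℕ.+ suc i)) (subst (1ℤ ℤ.≤_) (trans (ωIndex≡⊖ i k) (ℤₚ.⊖-≤ (k+1+i≤rank d≰k+i))) 1≤j)

  rankSum≥-small : ∀ {r k} → k < r → rankSum≥ r k ≡ 0ℤ
  rankSum≥-small {r} {k} k<r = rankSum≥-vanishes r k λ V T ∣V∣≡k T⊆V →
    ℕₚ.≤-<-trans (ℕₚ.≤-trans (ρ-bounded T) (Subsetₚ.p⊆q⇒∣p∣≤∣q∣ T⊆V)) (subst (_< r) (sym ∣V∣≡k) k<r)

  i≤rank-1 : ∀ {i} → suc i ≤ d → + i ℤ.≤ + d - 1ℤ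
  i≤rank-1 i<d = subst (+ _ ℤ.≤_) (sym (trans (ℤₚ.m-n≡m⊖n d 1) (ℤₚ.⊖-≥ (ℕₚ.≤-trans (s≤s z≤n) i<d))))
                       (ℤ.+≤+ (ℕₚ.∸-monoˡ-≤ 1 i<d))

  ω-below-rank : ∀ {i k} → suc i ≤ d → k ≤ m →
                 ω M (+ i) (ωIndex i k) ≡ signℤ (ωIndex i k) * - rankSum≥ (d ∸ i) k
  ω-below-rank {i} {k} i<d k≤m = trans
    (if-guard (1ℤ ≤ᵇℤ j) refl (dec-true (+ i ℤ.≤? + d - 1ℤ) (i≤rank-1 i<d))
                              (dec-true (j ℤ.≤? ωIndex i m) (ωIndex-monoʳ-≤ i k≤m)))
    (by-sign (d ℕ.≤? k ℕ.+ i))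
    where
    j = ωIndex i k
    by-sign : Dec (d ≤ k ℕ.+ i) →
              (if 1ℤ ≤ᵇℤ j then signℤ j * μSum i j else 0ℤ) ≡ signℤ j * - rankSum≥ (d ∸ i) k
    by-sign (yes d≤k+i) rewrite dec-true (1ℤ ℤ.≤? j) (1≤ωIndex d≤k+i) = cong (signℤ j *_) (μSum≡-rankSum≥ i k)
    by-sign (no d≰k+i)  rewrite dec-false (1ℤ ℤ.≤? j) (1≰ωIndex d≰k+i) =
      sym (trans (cong (λ x → signℤ j * - x) (rankSum≥-small k<d∸i)) (ℤₚ.*-zeroʳ (signℤ j)))
      where k<d∸i = ℕₚ.m+n≤o⇒m≤o∸n (suc k) (subst (_≤ d) (ℕₚ.+-suc k i) (k+1+i≤rank d≰k+i))

  rank≰rank-1 : 1 ≤ d → ¬ (+ d ℤ.≤ + d - 1ℤ)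
  rank≰rank-1 1≤d d≤d-1 =
    n≰n∸1 d 1≤d (ℤₚ.drop‿+≤+ (subst (+ d ℤ.≤_) (trans (ℤₚ.m-n≡m⊖n d 1) (ℤₚ.⊖-≥ 1≤d)) d≤d-1))

  ω-at-rank : 1 ≤ d → ∀ j → ω M (+ d) j ≡ 0ℤ
  ω-at-rank 1≤d j rewrite dec-false (+ d ℤ.≤? (+ d - 1ℤ)) (rank≰rank-1 1≤d) = refl

  δ-self : ∀ n → δ n n ≡ 1ℤ
  δ-self n = cong 𝟙 (dec-true (n ℕ.≟ n) refl)

  δ+signed-ω≡rankSum≥ : 1 ≤ d → ∀ {i k} → i ≤ d → k ≤ m →
    δ k 0 * δ i d + signℤ (+ k + + i - + d) * ω M (+ i) (+ k + + i - + d + 1ℤ) ≡ rankSum≥ (d ∸ i) k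
  δ+signed-ω≡rankSum≥ 1≤d {i} {k} i≤d k≤m with i ℕ.≟ d
  ... | yes refl = begin
    δ k 0 * δ i i + signℤ x * ω M (+ i) (x + 1ℤ)  ≡⟨ cong₂ (λ a b → δ k 0 * a + signℤ x * b) (δ-self i) (ω-at-rank 1≤d (x + 1ℤ)) ⟩
    δ k 0 * 1ℤ + signℤ x * 0ℤ                     ≡⟨ cong₂ _+_ (ℤₚ.*-identityʳ (δ k 0)) (ℤₚ.*-zeroʳ (signℤ x)) ⟩
    δ k 0 + 0ℤ                                    ≡⟨ ℤₚ.+-identityʳ (δ k 0) ⟩
    δ k 0                                         ≡⟨ rankSum≥-zero k ⟨
    rankSum≥ 0 k                                  ≡⟨ cong (λ r → rankSum≥ r k) (ℕₚ.n∸n≡0 i) ⟨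
    rankSum≥ (i ∸ i) k                            ∎
    where
    open ≡-Reasoning
    x = + k + + i - + i
  ... | no i≢d = begin
    δ k 0 * δ i d + signℤ x * ω M (+ i) (x + 1ℤ)
      ≡⟨ cong₂ (λ a b → δ k 0 * a + signℤ x * b) (cong 𝟙 (dec-false (i ℕ.≟ d) i≢d))
               (trans (cong (ω M (+ i)) x+1≡) (ω-below-rank (ℕₚ.≤∧≢⇒< i≤d i≢d) k≤m)) ⟩
    δ k 0 * 0ℤ + signℤ x * (signℤ (ωIndex i k) * - G)
      ≡⟨ cong (λ y → δ k 0 * 0ℤ + signℤ x * (signℤ y * - G)) x+1≡ ⟨
    δ k 0 * 0ℤ + signℤ x * (signℤ (x + 1ℤ) * - G)
      ≡⟨ c*0+a*[b*-g]≡-[a*b*g] (δ k 0) (signℤ x) (signℤ (x + 1ℤ)) G ⟩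
    - (signℤ x * signℤ (x + 1ℤ) * G)
      ≡⟨ cong (λ s → - (s * G)) (signℤ-*-signℤ-suc x) ⟩
    - (- 1ℤ * G)
      ≡⟨ -[-1*g]≡g G ⟩
    G ∎
    where
    open ≡-Reasoning
    x = + k + + i - + d
    G = rankSum≥ (d ∸ i) k
    x+1≡ : x + 1ℤ ≡ ωIndex i k
    x+1≡ = x+z-y+1≡x-y+1+z (+ k) (+ d) (+ i)
      where
      x+z-y+1≡x-y+1+z : ∀ x y z → x + z - y + 1ℤ ≡ x - y + 1ℤ + z
      x+z-y+1≡x-y+1+z = solve-∀
    c*0+a*[b*-g]≡-[a*b*g] : ∀ c a b g → c * 0ℤ + a * (b * - g) ≡ - (a * b * g)
    c*0+a*[b*-g]≡-[a*b*g] = solve-∀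
    -[-1*g]≡g : ∀ g → - (- 1ℤ * g) ≡ g
    -[-1*g]≡g = solve-∀

  signed-ω[i-1]≡-rankSum≥ : ∀ {i k} → i ≤ d → k ≤ m →
    signℤ (+ k + + i - + d) * ω M (+ i - 1ℤ) (+ k + + i - + d) ≡ - rankSum≥ (suc (d ∸ i)) k
  signed-ω[i-1]≡-rankSum≥ {zero} {k} _ _ =
    trans (ℤₚ.*-zeroʳ (signℤ (+ k + + 0 - + d))) (sym (cong -_ (rankSum≥-above-rank k)))
  signed-ω[i-1]≡-rankSum≥ {suc i} {k} i<d k≤m = begin
    signℤ x * ω M (+ i) x
      ≡⟨ cong (λ y → signℤ y * ω M (+ i) y) x≡ ⟩
    signℤ (ωIndex i k) * ω M (+ i) (ωIndex i k)
      ≡⟨ cong (signℤ (ωIndex i k) *_) (ω-below-rank i<d k≤m) ⟩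
    signℤ (ωIndex i k) * (signℤ (ωIndex i k) * - G)
      ≡⟨ a*[a*-g]≡-[a*a*g] (signℤ (ωIndex i k)) G ⟩
    - (signℤ (ωIndex i k) * signℤ (ωIndex i k) * G)
      ≡⟨ cong (λ s → - (s * G)) (signℤ-sq (ωIndex i k)) ⟩
    - (1ℤ * G)
      ≡⟨ cong -_ (ℤₚ.*-identityˡ G) ⟩
    - G
      ≡⟨ cong (λ r → - rankSum≥ r k) (ℕₚ.+-∸-assoc 1 i<d) ⟩
    - rankSum≥ (suc (d ∸ suc i)) k ∎
    where
    open ≡-Reasoning
    x = + k + + suc i - + d
    G = rankSum≥ (d ∸ i) k
    x≡ : x ≡ ωIndex i k
    x≡ = x+[1+z]-y≡x-y+1+z (+ k) (+ d) (+ i)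
      where
      x+[1+z]-y≡x-y+1+z : ∀ x y z → x + (1ℤ + z) - y ≡ x - y + 1ℤ + z
      x+[1+z]-y≡x-y+1+z = solve-∀
    a*[a*-g]≡-[a*a*g] : ∀ a g → a * (a * - g) ≡ - (a * a * g)
    a*[a*-g]≡-[a*a*g] = solve-∀

  coeff-Y1m-in-range : 1 ≤ d → ∀ i k → i ≤ d → k ≤ m →
    coeff k i (Y1m M) ≡ δ k 0 * δ i d
      + signℤ (+ k + + i - + d) * (ω M (+ i) (+ k + + i - + d + 1ℤ) + ω M (+ i - 1ℤ) (+ k + + i - + d))
  coeff-Y1m-in-range 1≤d i k i≤d k≤m = begin
    coeff k i (Y1m M)
      ≡⟨ coeff-Y1m≡rankSum≥ k i i≤d ⟩
    rankSum≥ (d ∸ i) k - rankSum≥ (suc (d ∸ i)) k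
      ≡⟨ cong₂ _+_ (δ+signed-ω≡rankSum≥ 1≤d i≤d k≤m) (signed-ω[i-1]≡-rankSum≥ i≤d k≤m) ⟨
    δ k 0 * δ i d + s * ω₁ + s * ω₂
      ≡⟨ a+s*b+s*c≡a+s*[b+c] (δ k 0 * δ i d) s ω₁ ω₂ ⟩
    δ k 0 * δ i d + s * (ω₁ + ω₂) ∎
    where
    open ≡-Reasoning
    s = signℤ (+ k + + i - + d)
    ω₁ = ω M (+ i) (+ k + + i - + d + 1ℤ)
    ω₂ = ω M (+ i - 1ℤ) (+ k + + i - + d)
    a+s*b+s*c≡a+s*[b+c] : ∀ a s b c → a + s * b + s * c ≡ a + s * (b + c)
    a+s*b+s*c≡a+s*[b+c] = solve-∀

  coeff-above-rank : ∀ i k → d < i → coeff k i (Y1m M) ≡ 0ℤ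
  coeff-above-rank i k d<i = trans (coeff-Y1m k i) (∑-zero (allSubsets m) λ V →
    trans (cong (𝟙 (k ≡ᵇ card V) *_) (∑-zero (allSubsets m) (λ T →
            trans (cong (λ b → μ⊆ T V * 𝟙 b) (i≢d∸ρ T)) (ℤₚ.*-zeroʳ (μ⊆ T V)))))
          (ℤₚ.*-zeroʳ (𝟙 (k ≡ᵇ card V))))
    where
    i≢d∸ρ : ∀ T → (i ≡ᵇ d ∸ ρ T) ≡ false
    i≢d∸ρ T = dec-false (i ℕ.≟ d ∸ ρ T) (λ i≡ → ℕₚ.<⇒≱ d<i (subst (_≤ d) (sym i≡) (ℕₚ.m∸n≤m d (ρ T))))

  coeff-many-loops : ∀ i k → m ∸ loops M < k → coeff k i (Y1m M) ≡ 0ℤ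
  coeff-many-loops i k many = trans (coeff-Y1m k i) (∑-zero (allSubsets m) V-term)
    where
    isLoop : Fin m → Bool
    isLoop e = does (ρ ⁅ e ⁆ ℕ.≟ 0)
    V-term : ∀ V → 𝟙 (k ≡ᵇ card V) * ∑ₛ m (λ T → μ⊆ T V * 𝟙 (i ≡ᵇ d ∸ ρ T)) ≡ 0ℤ
    V-term V with k ≡ᵇ card V in k≡∣V∣
    ... | false = refl
    ... | true with pigeonhole m V isLoop
    ...   | inj₁ (e , e∈V , loop) = cong (1ℤ *_) (∑-μ⊆-toggle m V e e∈V (λ T → 𝟙 (i ≡ᵇ d ∸ ρ T))
              (λ T → cong (λ r → 𝟙 (i ≡ᵇ d ∸ r)) (ρ-loop e (≡ᵇ⇒≡ loop) T)))
    ...   | inj₂ bound = ⊥-elim (ℕₚ.<⇒≱ many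
              (subst (_≤ m ∸ loops M) (sym (≡ᵇ⇒≡ k≡∣V∣)) (ℕₚ.m+n≤o⇒m≤o∸n (card V) bound)))

  coeff-Y1m-out-of-range : ∀ i k → ¬ (i ≤ d × k ≤ m ∸ loops M) → coeff k i (Y1m M) ≡ 0ℤ
  coeff-Y1m-out-of-range i k outside-range with i ℕ.≤? d | k ℕ.≤? m ∸ loops M
  ... | yes i≤d | yes k≤  = ⊥-elim (outside-range (i≤d , k≤))
  ... | no i≰d  | _       = coeff-above-rank i k (ℕₚ.≰⇒> i≰d)
  ... | yes _   | no k≰   = coeff-many-loops i k (ℕₚ.≰⇒> k≰)

corollary2p7 : (m : ℕ) (M : Matroid m) → 1 ≤ rank M →
    ((i k : ℕ) → i ≤ rank M → k ≤ m ∸ loops M →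
      coeff k i (Y1m M) ≡ δ k 0 * δ i (rank M)
        + signℤ (+ k + + i - + rank M)
          * (ω M (+ i) (+ k + + i - + rank M + 1ℤ) + ω M (+ i - 1ℤ) (+ k + + i - + rank M)))
    × ((i k : ℕ) → ¬ (i ≤ rank M × k ≤ m ∸ loops M) → coeff k i (Y1m M) ≡ 0ℤ)
corollary2p7 m M 1≤d =
    (λ i k i≤d k≤m-ℓ → coeff-Y1m-in-range 1≤d i k i≤d (ℕₚ.≤-trans k≤m-ℓ (ℕₚ.m∸n≤m m (loops M))))
  , coeff-Y1m-out-of-range
  where open Coefficients M
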